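{- Let $p\ge 5$ be a prime and $m\in \mathbb{Z}^{+}$. Then \begin{align*} \sum_{\substack{1\le k\le (p^m-1)/2\\ p\nmid k}}\frac{(-1)^{k}}{k^3}\equiv -\frac{1}{4}B_{p-3}\pmod{p}. \end{align*}
   Context: The sum runs over $k$ not divisible by $p$. $B_n$ are the Bernoulli numbers defined by $z/(e^z-1)=\sum_{n\ge0}B_n z^n/n!$. -}

module Defs where

open import Data.Nat as ℕ using (ℕ; zero; suc; _∸_; _^_)
open import Data.Nat.Combinatorics using (_C_)
open import Data.Nat.Divisibility using (_∣_)
open import Data.Nat.DivMod using (_/_)
open import Data.Integer as ℤ using (ℤ; +_)
open import Data.Rational as ℚ using (ℚ; 0ℚ; 1ℚ; ↥_; ↧ₙ_; _+_; _*_; _-_; -_)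
open import Data.List using (List; []; _∷_; reverse; length)
open import Relation.Nullary using (¬_; Dec; yes; no)
open import Data.Product using (_×_)
import Data.Nat.Properties

-- Bernoulli numbers, z/(e^z-1) = Σ B_n z^n/n!, i.e. B_0 = 1 and for n ≥ 1
--   B_n = -(1/(n+1)) Σ_{k=0}^{n-1} C(n+1,k) B_k   (so B_1 = -1/2).
-- bernList n = [B_n, B_{n-1}, ..., B_0]
private
  -- given [B_{n-1},...,B_0] (length n) compute Σ_{k=0}^{n-1} C(n+1,k) B_k
  -- the list head is B_{n-1}; element at index i from the head is B_{n-1-i}
  sumC : ℕ → ℕ → List ℚ → ℚ
  sumC n i []       = 0ℚ
  sumC n i (b ∷ bs) = (((+ ((suc n) C (n ∸ suc i))) ℚ./ 1) * b) + sumC n (suc i) bs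

bernList : ℕ → List ℚ
bernList zero    = 1ℚ ∷ []
bernList (suc n) = (- ((+ 1 ℚ./ suc (suc n)) * sumC (suc n) 0 prev)) ∷ prev
  where prev = bernList n

headOr0 : List ℚ → ℚ
headOr0 []      = 0ℚ
headOr0 (x ∷ _) = x

B : ℕ → ℚ
B n = headOr0 (bernList n)

-- Congruence of rationals modulo a natural number p:
-- a ≡ b (mod p) iff the reduced fraction a - b has numerator divisible by p
-- and denominator not divisible by p (i.e. a - b ∈ p ℤ_(p)).
_≡ℚ_[mod_] : ℚ → ℚ → ℕ → Set
a ≡ℚ b [mod p ] = (p ∣ ℤ.∣ ↥ (a - b) ∣) × ¬ (p ∣ ↧ₙ (a - b))

signℤ : ℕ → ℤ
signℤ zero    = + 1
signℤ (suc k) = ℤ.- signℤ k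

altSum3 : (p : ℕ) → ℕ → ℚ
altSum3 p zero    = 0ℚ
altSum3 p (suc j) with p Data.Nat.Divisibility.∣? suc j
... | yes _ = altSum3 p j
... | no  _ = altSum3 p j + (signℤ (suc j) ℚ./ (suc j ^ 3))
  where instance _ = ℕ.>-nonZero (Data.Nat.Properties.m^n>0 (suc j) 3)

{-# OPTIONS --safe #-}
-- Write p = 2h + 1 and e = p - 4, so that k ^ e ≡ k ^ -3 (mod p) when p ∤ k, and let
-- T = ∑_{k ≤ h} (-1) ^ k k ^ e.  The summand changes sign under k ↦ k + p and is invariant
-- under k ↦ p - k modulo p; hence every partial sum up to h + pt is ≡ T, and (p ^ m - 1) / 2
-- has this form.  Splitting ∑_{k ≤ 2h} once by k ↔ p - k and once into even and odd k gives
-- T ≡ 2 ^ e A with A = ∑_{k ≤ h} k ^ e.  Doing the same for ∑_{k < p} k ^ (p - 3) modulo p²,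
-- which is ≡ p B_{p-3} by the power-sum recursion of the Bernoulli numbers, gives
-- (2 ^ (e + 1) - 1) B_{p-3} + (p - 3) 2 ^ e A ≡ 0 (mod p); with 2 ^ (e + 3) ≡ 1 this becomes
-- T ≡ -B_{p-3} / 4.
module Submission where

open import Defs using (signℤ; _≡ℚ_[mod_]; B; bernList; altSum3)

open import Level using (0ℓ)
open import Algebra.Core using (Op₁; Op₂)
open import Algebra.Bundles using (AbelianGroup; CommutativeSemigroup)
open import Algebra.Structures using (IsCommutativeRing)
import Algebra.Properties.AbelianGroup as AbelianGroupProperties
import Algebra.Properties.CommutativeSemigroup as CommutativeSemigroupProperties
open import Data.Empty using (⊥; ⊥-elim)
open import Data.List using (List; _∷_; [])
open import Data.Product using (_×_; _,_; ∃-syntax)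
open import Data.Sum using (_⊎_; inj₁; inj₂)
open import Data.Nat as ℕ using (ℕ; zero; suc; _∸_; _<_; _≤_; z≤n; s≤s)
import Data.Nat.Properties as ℕP
open import Data.Nat.Combinatorics using (_C_; nCn≡1; nC1≡n; nCk≡nC[n∸k]; k>n⇒nCk≡0; nCk+nC[k+1]≡[n+1]C[k+1])
import Data.Nat.Coprimality as Coprimality
open import Data.Nat.DivMod using (m*n/n≡m)
open import Data.Nat.Divisibility using (_∣_; _∣?_; divides; ∣⇒≤; ∣1⇒≡1; ∣-refl; ∣-trans; ∣m∣n⇒∣m+n; ∣m+n∣m⇒∣n)
open import Data.Nat.Induction using (<-rec)
open import Data.Nat.Primality using (Prime; euclidsLemma; prime⇒nonTrivial; prime⇒irreducible)
open import Data.Integer as ℤ using (ℤ; +_)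
import Data.Integer.Properties as ℤP
open import Data.Integer.Divisibility.Signed as Signed using (∣ᵤ⇒∣)
open import Data.Rational as ℚ using (ℚ; 0ℚ; 1ℚ; mkℚ; ↥_; ↧ₙ_)
import Data.Rational.Properties as ℚP
open import Data.Rational.Unnormalised as ℚᵘ using (mkℚᵘ; *≡*)
import Data.Rational.Unnormalised.Properties as ℚᵘP
open import Relation.Nullary using (¬_; yes; no)
open import Relation.Nullary.Decidable using (dec⇒maybe)
open import Relation.Binary.Bundles using (Setoid)
open import Relation.Binary.PropositionalEquality
  using (_≡_; refl; sym; trans; cong; cong₂; subst; subst₂; module ≡-Reasoning)
import Relation.Binary.Reasoning.Setoid as SetoidReasoning
open import Tactic.RingSolver using (solve-∀; solve)
open import Tactic.RingSolver.Core.AlmostCommutativeRing using (AlmostCommutativeRing; fromCommutativeRing)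
open import Data.Nat.Tactic.RingSolver using () renaming (ring to ℕ-ring)
open import Data.Integer.Tactic.RingSolver using () renaming (ring to ℤ-ring)

module FiniteSums {A : Set} {_+_ _*_ : Op₂ A} { -_ : Op₁ A} {0# 1# : A}
  (isCommutativeRing : IsCommutativeRing _≡_ _+_ _*_ -_ 0# 1#) where

  open IsCommutativeRing isCommutativeRing
    using (+-assoc; +-comm; +-identityˡ; +-identityʳ; distribˡ; zeroʳ;
           +-isCommutativeSemigroup; +-isAbelianGroup)

  +-commutativeSemigroup : CommutativeSemigroup 0ℓ 0ℓ
  +-commutativeSemigroup = record { isCommutativeSemigroup = +-isCommutativeSemigroup }

  +-abelianGroup : AbelianGroup 0ℓ 0ℓ
  +-abelianGroup = record { isAbelianGroup = +-isAbelianGroup }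

  open CommutativeSemigroupProperties +-commutativeSemigroup using (interchange)
  open AbelianGroupProperties +-abelianGroup using (ε⁻¹≈ε; ⁻¹-∙-comm)
  open ≡-Reasoning

  ∑ : ℕ → (ℕ → A) → A
  ∑ zero    f = 0#
  ∑ (suc n) f = ∑ n f + f n

  -- ∑ n f sums f over 0 ≤ k < n, ∑₁ n f over 1 ≤ k ≤ n.
  ∑₁ : ℕ → (ℕ → A) → A
  ∑₁ n f = ∑ n (λ k → f (suc k))

  ∑-preserves : (_~_ : A → A → Set) → 0# ~ 0# →
                (∀ {a b c d} → a ~ b → c ~ d → (a + c) ~ (b + d)) →
                ∀ n {f g} → (∀ {k} → k < n → f k ~ g k) → ∑ n f ~ ∑ n g
  ∑-preserves _~_ ~-0 ~-+ zero    f~g = ~-0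
  ∑-preserves _~_ ~-0 ~-+ (suc n) f~g =
    ~-+ (∑-preserves _~_ ~-0 ~-+ n (λ k<n → f~g (ℕP.m<n⇒m<1+n k<n))) (f~g (ℕP.n<1+n n))

  ∑-closed : (P : A → Set) → P 0# → (∀ {a b} → P a → P b → P (a + b)) →
             ∀ n {f} → (∀ {k} → k < n → P (f k)) → P (∑ n f)
  ∑-closed P P0 P+ n {f} = ∑-preserves (λ a _ → P a) P0 P+ n {f} {f}

  ∑-cong : ∀ n {f g} → (∀ {k} → k < n → f k ≡ g k) → ∑ n f ≡ ∑ n g
  ∑-cong = ∑-preserves _≡_ refl (cong₂ _+_)

  ∑-ext : ∀ n {f g} → (∀ k → f k ≡ g k) → ∑ n f ≡ ∑ n g
  ∑-ext n f≗g = ∑-cong n (λ {k} _ → f≗g k)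

  ∑-zero : ∀ n → ∑ n (λ _ → 0#) ≡ 0#
  ∑-zero zero    = refl
  ∑-zero (suc n) = trans (+-identityʳ _) (∑-zero n)

  ∑-distrib-+ : ∀ n f g → ∑ n (λ k → f k + g k) ≡ ∑ n f + ∑ n g
  ∑-distrib-+ zero    f g = sym (+-identityˡ 0#)
  ∑-distrib-+ (suc n) f g =
    trans (cong (_+ (f n + g n)) (∑-distrib-+ n f g)) (interchange (∑ n f) (∑ n g) (f n) (g n))

  *-distribˡ-∑ : ∀ n c f → c * ∑ n f ≡ ∑ n (λ k → c * f k)
  *-distribˡ-∑ zero    c f = zeroʳ c
  *-distribˡ-∑ (suc n) c f = trans (distribˡ c (∑ n f) (f n)) (cong (_+ (c * f n)) (*-distribˡ-∑ n c f))

  neg-distrib-∑ : ∀ n f → - ∑ n f ≡ ∑ n (λ k → - f k)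
  neg-distrib-∑ zero    f = ε⁻¹≈ε
  neg-distrib-∑ (suc n) f = trans (sym (⁻¹-∙-comm (∑ n f) (f n))) (cong (_+ - f n) (neg-distrib-∑ n f))

  ∑-linear : ∀ n c f g → ∑ n (λ k → f k + (- (c * g k))) ≡ ∑ n f + (- (c * ∑ n g))
  ∑-linear n c f g = begin
    ∑ n (λ k → f k + (- (c * g k)))    ≡⟨ ∑-distrib-+ n f _ ⟩
    ∑ n f + ∑ n (λ k → - (c * g k))    ≡⟨ cong (λ t → ∑ n f + t) (neg-distrib-∑ n _) ⟨
    ∑ n f + (- ∑ n (λ k → c * g k))    ≡⟨ cong (λ t → ∑ n f + (- t)) (*-distribˡ-∑ n c g) ⟨
    ∑ n f + (- (c * ∑ n g))            ∎

  ∑-split : ∀ a b f → ∑ (a ℕ.+ b) f ≡ ∑ a f + ∑ b (λ k → f (a ℕ.+ k))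
  ∑-split a zero    f rewrite ℕP.+-identityʳ a = sym (+-identityʳ (∑ a f))
  ∑-split a (suc b) f rewrite ℕP.+-suc a b =
    trans (cong (_+ f (a ℕ.+ b)) (∑-split a b f)) (+-assoc (∑ a f) _ _)

  ∑-first : ∀ n f → ∑ (suc n) f ≡ f 0 + ∑₁ n f
  ∑-first n f = trans (∑-split 1 n f) (cong (_+ ∑₁ n f) (+-identityˡ (f 0)))

  ∑-reverse : ∀ n f → ∑ n f ≡ ∑ n (λ k → f (n ∸ suc k))
  ∑-reverse zero    f = refl
  ∑-reverse (suc n) f = begin
    ∑ n f + f n                         ≡⟨ cong (_+ f n) (∑-reverse n f) ⟩
    ∑ n (λ k → f (n ∸ suc k)) + f n     ≡⟨ +-comm _ (f n) ⟩
    f n + ∑ n (λ k → f (n ∸ suc k))     ≡⟨ ∑-first n (λ k → f (suc n ∸ suc k)) ⟨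
    ∑ (suc n) (λ k → f (suc n ∸ suc k)) ∎

  ∑-even-odd : ∀ n f → ∑ (n ℕ.+ n) f ≡ ∑ n (λ k → f (k ℕ.+ k)) + ∑ n (λ k → f (suc (k ℕ.+ k)))
  ∑-even-odd zero    f = sym (+-identityˡ 0#)
  ∑-even-odd (suc n) f rewrite ℕP.+-suc n n = begin
    (∑ (n ℕ.+ n) f + f (n ℕ.+ n)) + f (suc (n ℕ.+ n))  ≡⟨ cong (λ t → (t + f (n ℕ.+ n)) + f (suc (n ℕ.+ n))) (∑-even-odd n f) ⟩
    ((E + O) + f (n ℕ.+ n)) + f (suc (n ℕ.+ n))       ≡⟨ +-assoc (E + O) _ _ ⟩
    (E + O) + (f (n ℕ.+ n) + f (suc (n ℕ.+ n)))       ≡⟨ interchange E O _ _ ⟩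
    (E + f (n ℕ.+ n)) + (O + f (suc (n ℕ.+ n)))       ∎
    where
    E = ∑ n (λ k → f (k ℕ.+ k))
    O = ∑ n (λ k → f (suc (k ℕ.+ k)))

  ∑₁-split : ∀ a b f → ∑₁ (a ℕ.+ b) f ≡ ∑₁ a f + ∑₁ b (λ k → f (a ℕ.+ k))
  ∑₁-split a b f = trans (∑-split a b (λ k → f (suc k)))
    (cong (λ t → ∑₁ a f + t) (∑-ext b (λ k → cong f (sym (ℕP.+-suc a k)))))

  ∑₁-reflect : ∀ h f → ∑₁ (h ℕ.+ h) f ≡ ∑₁ h f + ∑₁ h (λ k → f (suc (h ℕ.+ h) ∸ k))
  ∑₁-reflect h f = trans (∑₁-split h h f) (cong (λ t → ∑₁ h f + t) (trans
    (∑-reverse h (λ k → f (h ℕ.+ suc k)))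
    (∑-cong h (λ {k} k<h → cong f (reflected-index k<h)))))
    where
    reflected-index : ∀ {k} → k < h → h ℕ.+ suc (h ∸ suc k) ≡ suc (h ℕ.+ h) ∸ suc k
    reflected-index {k} k<h = begin
      h ℕ.+ suc (h ∸ suc k)  ≡⟨ cong (h ℕ.+_) (ℕP.+-∸-assoc 1 k<h) ⟨
      h ℕ.+ (h ∸ k)          ≡⟨ ℕP.+-∸-assoc h (ℕP.<⇒≤ k<h) ⟨
      (h ℕ.+ h) ∸ k          ∎

  ∑₁-parity : ∀ h f → ∑₁ (h ℕ.+ h) f ≡
              ∑₁ h (λ k → f (k ℕ.+ k)) + ∑₁ h (λ k → f (suc (h ℕ.+ h) ∸ (k ℕ.+ k)))
  ∑₁-parity h f = begin
    ∑₁ (h ℕ.+ h) f                 ≡⟨ ∑-even-odd h (λ k → f (suc k)) ⟩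
    Odd + ∑ h (λ k → f (suc (suc (k ℕ.+ k))))
      ≡⟨ cong (λ t → Odd + t) (∑-ext h (λ k → cong f (cong suc (sym (ℕP.+-suc k k))))) ⟩
    Odd + ∑₁ h (λ k → f (k ℕ.+ k))
      ≡⟨ cong (_+ ∑₁ h (λ k → f (k ℕ.+ k))) (trans (∑-reverse h _) (∑-cong h (λ k<h → cong f (odd-index k<h)))) ⟩
    ∑₁ h (λ k → f (suc (h ℕ.+ h) ∸ (k ℕ.+ k))) + ∑₁ h (λ k → f (k ℕ.+ k))
      ≡⟨ +-comm _ _ ⟩
    ∑₁ h (λ k → f (k ℕ.+ k)) + ∑₁ h (λ k → f (suc (h ℕ.+ h) ∸ (k ℕ.+ k))) ∎
    where
    Odd = ∑ h (λ k → f (suc (k ℕ.+ k)))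
    odd-index : ∀ {k} → k < h → suc ((h ∸ suc k) ℕ.+ (h ∸ suc k)) ≡ suc (h ℕ.+ h) ∸ (suc k ℕ.+ suc k)
    odd-index {k} k<h = begin
      suc (j ℕ.+ j)                          ≡⟨ ℕP.m+n∸m≡n (suc k ℕ.+ suc k) _ ⟨
      (suc k ℕ.+ suc k) ℕ.+ suc (j ℕ.+ j) ∸ (suc k ℕ.+ suc k)
        ≡⟨ cong (_∸ (suc k ℕ.+ suc k)) (rearrange k j) ⟩
      suc ((suc k ℕ.+ j) ℕ.+ (suc k ℕ.+ j)) ∸ (suc k ℕ.+ suc k)
        ≡⟨ cong (λ t → suc (t ℕ.+ t) ∸ (suc k ℕ.+ suc k)) (ℕP.m+[n∸m]≡n k<h) ⟩
      suc (h ℕ.+ h) ∸ (suc k ℕ.+ suc k)      ∎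
      where
      j = h ∸ suc k
      rearrange : ∀ a b → (suc a ℕ.+ suc a) ℕ.+ suc (b ℕ.+ b) ≡ suc ((suc a ℕ.+ b) ℕ.+ (suc a ℕ.+ b))
      rearrange = solve-∀ ℕ-ring

module IntegerArithmetic where
  open import Data.Integer using (_+_; _*_; -_; _-_; _^_)
  open FiniteSums ℤP.+-*-isCommutativeRing public

  infix 4 _≡ℤ_[mod_]
  record _≡ℤ_[mod_] (a b M : ℤ) : Set where
    constructor congruent
    field
      quotient : ℤ
      equation : a ≡ b + M * quotient

  ≡ℤ-reflexive : ∀ {M a b} → a ≡ b → a ≡ℤ b [mod M ]
  ≡ℤ-reflexive {M} {a} refl = congruent (+ 0) (solve (a ∷ M ∷ []) ℤ-ring)

  ≡ℤ-refl : ∀ {M a} → a ≡ℤ a [mod M ]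
  ≡ℤ-refl = ≡ℤ-reflexive refl

  ≡ℤ-sym : ∀ {M a b} → a ≡ℤ b [mod M ] → b ≡ℤ a [mod M ]
  ≡ℤ-sym {M} {b = b} (congruent x refl) = congruent (- x) (solve (b ∷ M ∷ x ∷ []) ℤ-ring)

  ≡ℤ-trans : ∀ {M a b c} → a ≡ℤ b [mod M ] → b ≡ℤ c [mod M ] → a ≡ℤ c [mod M ]
  ≡ℤ-trans {M} {c = c} (congruent x refl) (congruent y refl) =
    congruent (y + x) (solve (c ∷ M ∷ x ∷ y ∷ []) ℤ-ring)

  ≡ℤ-setoid : ℤ → Setoid 0ℓ 0ℓ
  ≡ℤ-setoid M = record
    { _≈_ = _≡ℤ_[mod M ]
    ; isEquivalence = record { refl = ≡ℤ-refl ; sym = ≡ℤ-sym ; trans = ≡ℤ-trans } }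

  module ≡ℤ-Reasoning (M : ℤ) = SetoidReasoning (≡ℤ-setoid M)

  ≡ℤ-+ : ∀ {M a b c d} → a ≡ℤ b [mod M ] → c ≡ℤ d [mod M ] → a + c ≡ℤ b + d [mod M ]
  ≡ℤ-+ {M} {b = b} {d = d} (congruent x refl) (congruent y refl) =
    congruent (x + y) (solve (b ∷ d ∷ M ∷ x ∷ y ∷ []) ℤ-ring)

  ≡ℤ-+ˡ : ∀ {M a b} c → a ≡ℤ b [mod M ] → c + a ≡ℤ c + b [mod M ]
  ≡ℤ-+ˡ c = ≡ℤ-+ (≡ℤ-refl {a = c})

  ≡ℤ-neg : ∀ {M a b} → a ≡ℤ b [mod M ] → - a ≡ℤ - b [mod M ]
  ≡ℤ-neg {M} {b = b} (congruent x refl) = congruent (- x) (solve (b ∷ M ∷ x ∷ []) ℤ-ring)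

  ≡ℤ-*ˡ : ∀ {M a b} k → a ≡ℤ b [mod M ] → k * a ≡ℤ k * b [mod M ]
  ≡ℤ-*ˡ {M} {b = b} k (congruent x refl) = congruent (k * x) (solve (k ∷ b ∷ M ∷ x ∷ []) ℤ-ring)

  ≡ℤ-∑ : ∀ {M} n {f g} → (∀ {k} → k < n → f k ≡ℤ g k [mod M ]) → ∑ n f ≡ℤ ∑ n g [mod M ]
  ≡ℤ-∑ = ∑-preserves _≡ℤ_[mod _ ] ≡ℤ-refl ≡ℤ-+

  ≡ℤ-multiple : ∀ {M} x → M * x ≡ℤ + 0 [mod M ]
  ≡ℤ-multiple {M} x = congruent x (sym (ℤP.+-identityˡ (M * x)))

  ∣⇒≡ℤ0 : ∀ {M m} y → M ∣ m → + m * y ≡ℤ + 0 [mod + M ]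
  ∣⇒≡ℤ0 {M} {m} y (divides c m≡cM) = ≡ℤ-trans (≡ℤ-reflexive (begin
    + m * y              ≡⟨ cong (λ t → t * y) (trans (cong +_ m≡cM) (ℤP.pos-* c M)) ⟩
    (+ c * + M) * y      ≡⟨ rearrange (+ c) (+ M) y ⟩
    + M * (+ c * y)      ∎)) (≡ℤ-multiple (+ c * y))
    where
    open ≡-Reasoning
    rearrange : ∀ c M y → (c * M) * y ≡ M * (c * y)
    rearrange = solve-∀ ℤ-ring

  ≡ℤ-cancel : ∀ {p k a b} → Prime p → ¬ p ∣ k →
              + k * a ≡ℤ + k * b [mod + p ] → a ≡ℤ b [mod + p ]
  ≡ℤ-cancel {p} {k} {a} {b} p-prime p∤k (congruent x eq) = from-difference (∣ᵤ⇒∣ p∣∣a-b∣)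
    where
    open ≡-Reasoning
    k∣a-b∣≡p∣x∣ : k ℕ.* ℤ.∣ a - b ∣ ≡ p ℕ.* ℤ.∣ x ∣
    k∣a-b∣≡p∣x∣ = begin
      k ℕ.* ℤ.∣ a - b ∣      ≡⟨ ℤP.abs-* (+ k) (a - b) ⟨
      ℤ.∣ + k * (a - b) ∣    ≡⟨ cong ℤ.∣_∣ (difference (+ k) (+ p) eq) ⟩
      ℤ.∣ + p * x ∣          ≡⟨ ℤP.abs-* (+ p) x ⟩
      p ℕ.* ℤ.∣ x ∣          ∎
      where
      difference : ∀ K P → K * a ≡ K * b + P * x → K * (a - b) ≡ P * x
      difference K P Ka≡Kb+Px = begin
        K * (a - b)            ≡⟨ solve (K ∷ a ∷ b ∷ []) ℤ-ring ⟩
        K * a - K * b          ≡⟨ cong (_- K * b) Ka≡Kb+Px ⟩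
        K * b + P * x - K * b  ≡⟨ solve (K ∷ b ∷ P ∷ x ∷ []) ℤ-ring ⟩
        P * x                  ∎
    p∣∣a-b∣ : p ∣ ℤ.∣ a - b ∣
    p∣∣a-b∣ with euclidsLemma k ℤ.∣ a - b ∣ p-prime (divides ℤ.∣ x ∣ (trans k∣a-b∣≡p∣x∣ (ℕP.*-comm p _)))
    ... | inj₁ p∣k       = ⊥-elim (p∤k p∣k)
    ... | inj₂ p∣∣a-b∣ = p∣∣a-b∣
    from-difference : + p Signed.∣ a - b → a ≡ℤ b [mod + p ]
    from-difference (Signed.divides y a-b≡yp) = congruent y (begin
      a                ≡⟨ solve (a ∷ b ∷ []) ℤ-ring ⟩
      b + (a - b)      ≡⟨ cong (λ t → b + t) a-b≡yp ⟩
      b + y * + p      ≡⟨ cong (λ t → b + t) (ℤP.*-comm y (+ p)) ⟩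
      b + + p * y      ∎)

  ^-distrib-* : ∀ a b m → (a * b) ^ m ≡ a ^ m * b ^ m
  ^-distrib-* a b zero    = refl
  ^-distrib-* a b (suc m) = trans (cong ((a * b) *_) (^-distrib-* a b m)) (swap a b (a ^ m) (b ^ m))
    where
    swap : ∀ a b x y → (a * b) * (x * y) ≡ (a * x) * (b * y)
    swap = solve-∀ ℤ-ring

  binomial : ∀ n x → (x + + 1) ^ n ≡ ∑ (suc n) (λ j → + (n C j) * x ^ j)
  binomial zero    x = refl
  binomial (suc n) x = begin
    (x + + 1) * (x + + 1) ^ n      ≡⟨ cong ((x + + 1) *_) (binomial n x) ⟩
    (x + + 1) * S                  ≡⟨ cong ((x + + 1) *_) S≡1+R ⟩
    (x + + 1) * (+ 1 + R)          ≡⟨ expand x R ⟩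
    + 1 + (x * (+ 1 + R) + R)      ≡⟨ cong (λ t → + 1 + (x * t + R)) S≡1+R ⟨
    + 1 + (x * S + R)              ≡⟨ cong (λ t → + 1 + (t + R)) (*-distribˡ-∑ (suc n) x _) ⟩
    + 1 + (∑ (suc n) (λ j → x * (+ (n C j) * x ^ j)) + R)
      ≡⟨ cong (λ t → + 1 + (t + R)) (∑-ext (suc n) (λ j → *-comm-middle x (+ (n C j)) (x ^ j))) ⟩
    + 1 + (∑ (suc n) (λ j → + (n C j) * x ^ suc j) + R)
      ≡⟨ cong (λ t → + 1 + t) (∑-distrib-+ (suc n) _ _) ⟨
    + 1 + ∑ (suc n) (λ j → + (n C j) * x ^ suc j + + (n C suc j) * x ^ suc j)
      ≡⟨ cong (λ t → + 1 + t) (∑-ext (suc n) pascal) ⟩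
    + 1 + ∑₁ (suc n) (λ j → + (suc n C j) * x ^ j)
      ≡⟨ ∑-first (suc n) (λ j → + (suc n C j) * x ^ j) ⟨
    ∑ (suc (suc n)) (λ j → + (suc n C j) * x ^ j) ∎
    where
    open ≡-Reasoning
    S = ∑ (suc n) (λ j → + (n C j) * x ^ j)
    R = ∑ (suc n) (λ j → + (n C suc j) * x ^ suc j)
    R′ = ∑₁ n (λ j → + (n C j) * x ^ j)
    S≡1+R : S ≡ + 1 + R
    S≡1+R = begin
      S                         ≡⟨ ∑-first n _ ⟩
      + 1 * + 1 + R′            ≡⟨ cong (λ t → + 1 + t) (ℤP.+-identityʳ R′) ⟨
      + 1 + (R′ + + 0)          ≡⟨ cong (λ c → + 1 + (R′ + + c * x ^ suc n)) (k>n⇒nCk≡0 (ℕP.n<1+n n)) ⟨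
      + 1 + R                   ∎
    expand : ∀ x R → (x + + 1) * (+ 1 + R) ≡ + 1 + (x * (+ 1 + R) + R)
    expand = solve-∀ ℤ-ring
    *-comm-middle : ∀ x c y → x * (c * y) ≡ c * (x * y)
    *-comm-middle = solve-∀ ℤ-ring
    pascal : ∀ j → + (n C j) * x ^ suc j + + (n C suc j) * x ^ suc j ≡ + (suc n C suc j) * x ^ suc j
    pascal j = trans (sym (ℤP.*-distribʳ-+ (x ^ suc j) (+ (n C j)) (+ (n C suc j))))
                     (cong (λ c → + c * x ^ suc j) (nCk+nC[k+1]≡[n+1]C[k+1] n j))

  [k+1]*[n+1]C[k+1]≡[n+1]*nCk : ∀ n k → suc k ℕ.* (suc n C suc k) ≡ suc n ℕ.* (n C k)
  [k+1]*[n+1]C[k+1]≡[n+1]*nCk n zero = begin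
    1 ℕ.* (suc n C 1)  ≡⟨ ℕP.*-identityˡ _ ⟩
    suc n C 1          ≡⟨ nC1≡n (suc n) ⟩
    suc n              ≡⟨ ℕP.*-identityʳ (suc n) ⟨
    suc n ℕ.* 1        ∎
    where open ≡-Reasoning
  [k+1]*[n+1]C[k+1]≡[n+1]*nCk zero    (suc k) = ℕP.*-zeroʳ (suc (suc k))
  [k+1]*[n+1]C[k+1]≡[n+1]*nCk (suc n) (suc k) = begin
    suc (suc k) ℕ.* (suc (suc n) C suc (suc k))
      ≡⟨ cong (suc (suc k) ℕ.*_) (nCk+nC[k+1]≡[n+1]C[k+1] (suc n) (suc k)) ⟨
    suc (suc k) ℕ.* (A ℕ.+ suc n C suc (suc k))
      ≡⟨ ℕP.*-distribˡ-+ (suc (suc k)) A _ ⟩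
    (A ℕ.+ suc k ℕ.* A) ℕ.+ suc (suc k) ℕ.* (suc n C suc (suc k))
      ≡⟨ cong₂ (λ s t → (A ℕ.+ s) ℕ.+ t) ([k+1]*[n+1]C[k+1]≡[n+1]*nCk n k) ([k+1]*[n+1]C[k+1]≡[n+1]*nCk n (suc k)) ⟩
    (A ℕ.+ suc n ℕ.* (n C k)) ℕ.+ suc n ℕ.* (n C suc k)
      ≡⟨ ℕP.+-assoc A _ _ ⟩
    A ℕ.+ (suc n ℕ.* (n C k) ℕ.+ suc n ℕ.* (n C suc k))
      ≡⟨ cong (A ℕ.+_) (ℕP.*-distribˡ-+ (suc n) (n C k) _) ⟨
    A ℕ.+ suc n ℕ.* (n C k ℕ.+ n C suc k)
      ≡⟨ cong (λ t → A ℕ.+ suc n ℕ.* t) (nCk+nC[k+1]≡[n+1]C[k+1] n k) ⟩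
    suc (suc n) ℕ.* A ∎
    where
    open ≡-Reasoning
    A = suc n C suc k

  [n+1]Cn≡n+1 : ∀ n → suc n C n ≡ suc n
  [n+1]Cn≡n+1 n = begin
    suc n C n              ≡⟨ nCk≡nC[n∸k] (ℕP.n≤1+n n) ⟩
    suc n C (suc n ∸ n)    ≡⟨ cong (suc n C_) (ℕP.m+n∸n≡m 1 n) ⟩
    suc n C 1              ≡⟨ nC1≡n (suc n) ⟩
    suc n                  ∎
    where open ≡-Reasoning

  prime∣pCk : ∀ {n k} → Prime (suc n) → suc k < suc n → suc n ∣ suc n C suc k
  prime∣pCk {n} {k} p-prime k<n
    with euclidsLemma (suc k) (suc n C suc k) p-prime
           (divides (n C k) (trans ([k+1]*[n+1]C[k+1]≡[n+1]*nCk n k) (ℕP.*-comm (suc n) _)))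
  ... | inj₁ p∣k+1 = ⊥-elim (ℕP.<⇒≱ k<n (∣⇒≤ p∣k+1))
  ... | inj₂ p∣C   = p∣C

  fermat-little : ∀ {n} → Prime (suc n) → ∀ k → (+ k) ^ suc n ≡ℤ + k [mod + suc n ]
  fermat-little p-prime zero    = ≡ℤ-refl
  fermat-little {n} p-prime (suc k) = begin
    (+ suc k) ^ suc n
      ≡⟨ cong (λ t → t ^ suc n) (ℤP.+-comm (+ 1) (+ k)) ⟩
    (+ k + + 1) ^ suc n
      ≡⟨ binomial (suc n) (+ k) ⟩
    ∑ (suc (suc n)) term
      ≡⟨ ∑-first (suc n) term ⟩
    term 0 + (∑₁ n term + term (suc n))
      ≈⟨ ≡ℤ-+ˡ (term 0) (≡ℤ-+ inner≡0 (≡ℤ-reflexive outer≡k^p)) ⟩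
    + 1 * + 1 + (+ 0 + (+ k) ^ suc n)
      ≈⟨ ≡ℤ-+ˡ (+ 1 * + 1) (≡ℤ-+ˡ (+ 0) (fermat-little p-prime k)) ⟩
    + 1 * + 1 + (+ 0 + + k)
      ≡⟨ cong (λ t → + 1 + t) (ℤP.+-identityˡ (+ k)) ⟩
    + suc k ∎
    where
    open ≡ℤ-Reasoning (+ suc n)
    term : ℕ → ℤ
    term j = + (suc n C j) * (+ k) ^ j
    inner≡0 : ∑₁ n term ≡ℤ + 0 [mod + suc n ]
    inner≡0 = ≡ℤ-trans (≡ℤ-∑ n multiple) (≡ℤ-reflexive (∑-zero n))
      where
      multiple : ∀ {j} → j < n → term (suc j) ≡ℤ + 0 [mod + suc n ]
      multiple j<n = ∣⇒≡ℤ0 _ (prime∣pCk p-prime (s≤s j<n))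
    outer≡k^p : term (suc n) ≡ (+ k) ^ suc n
    outer≡k^p = trans (cong (λ c → + c * (+ k) ^ suc n) (nCn≡1 (suc n))) (ℤP.*-identityˡ _)

  fermat : ∀ {n k} → Prime (suc n) → ¬ suc n ∣ k → (+ k) ^ n ≡ℤ + 1 [mod + suc n ]
  fermat {n} {k} p-prime p∤k = ≡ℤ-cancel p-prime p∤k (begin
    + k * (+ k) ^ n  ≈⟨ fermat-little p-prime k ⟩
    + k              ≡⟨ ℤP.*-identityʳ (+ k) ⟨
    + k * + 1        ∎)
    where open ≡ℤ-Reasoning (+ suc n)

  powerSum : ℕ → ℕ → ℤ
  powerSum j N = ∑ N (λ k → (+ k) ^ j)

  powerSum-zero : ∀ N → powerSum 0 N ≡ + N
  powerSum-zero zero    = refl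
  powerSum-zero (suc N) = trans (cong (_+ + 1) (powerSum-zero N)) (ℤP.+-comm (+ N) (+ 1))

  ∑-C-powerSum : ∀ n N → ∑ (suc n) (λ j → + (suc n C j) * powerSum j N) ≡ (+ N) ^ suc n
  ∑-C-powerSum n zero = trans (∑-ext (suc n) (λ j → ℤP.*-zeroʳ (+ (suc n C j)))) (∑-zero (suc n))
  ∑-C-powerSum n (suc N) = begin
    ∑ (suc n) (λ j → + (suc n C j) * (powerSum j N + (+ N) ^ j))
      ≡⟨ ∑-ext (suc n) (λ j → ℤP.*-distribˡ-+ (+ (suc n C j)) (powerSum j N) _) ⟩
    ∑ (suc n) (λ j → + (suc n C j) * powerSum j N + + (suc n C j) * (+ N) ^ j)
      ≡⟨ ∑-distrib-+ (suc n) _ _ ⟩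
    ∑ (suc n) (λ j → + (suc n C j) * powerSum j N) + ∑ (suc n) term
      ≡⟨ cong (_+ ∑ (suc n) term) (∑-C-powerSum n N) ⟩
    (+ N) ^ suc n + ∑ (suc n) term
      ≡⟨ ℤP.+-comm _ (∑ (suc n) term) ⟩
    ∑ (suc n) term + (+ N) ^ suc n
      ≡⟨ cong (λ t → ∑ (suc n) term + t) last-term ⟨
    ∑ (suc (suc n)) term
      ≡⟨ binomial (suc n) (+ N) ⟨
    (+ N + + 1) ^ suc n
      ≡⟨ cong (_^ suc n) (ℤP.+-comm (+ N) (+ 1)) ⟩
    (+ suc N) ^ suc n ∎
    where
    open ≡-Reasoning
    term : ℕ → ℤ
    term j = + (suc n C j) * (+ N) ^ j
    last-term : term (suc n) ≡ (+ N) ^ suc n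
    last-term = trans (cong (λ c → + c * (+ N) ^ suc n) (nCn≡1 (suc n))) (ℤP.*-identityˡ _)

  powerSum-recurrence : ∀ n N → + suc (suc n) * powerSum (suc n) N ≡
    (+ N) ^ suc (suc n) - ∑ (suc n) (λ j → + (suc (suc n) C j) * powerSum j N)
  powerSum-recurrence n N = begin
    + suc (suc n) * powerSum (suc n) N
      ≡⟨ cancel (∑ (suc n) term) _ ⟩
    (∑ (suc n) term + + suc (suc n) * powerSum (suc n) N) - ∑ (suc n) term
      ≡⟨ cong (λ c → (∑ (suc n) term + + c * powerSum (suc n) N) - ∑ (suc n) term) ([n+1]Cn≡n+1 (suc n)) ⟨
    ∑ (suc (suc n)) term - ∑ (suc n) term
      ≡⟨ cong (_- ∑ (suc n) term) (∑-C-powerSum (suc n) N) ⟩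
    (+ N) ^ suc (suc n) - ∑ (suc n) term ∎
    where
    open ≡-Reasoning
    term : ℕ → ℤ
    term j = + (suc (suc n) C j) * powerSum j N
    cancel : ∀ s t → t ≡ (s + t) - s
    cancel = solve-∀ ℤ-ring

  pos-^ : ∀ k m → (+ k) ^ m ≡ + (k ℕ.^ m)
  pos-^ k zero    = refl
  pos-^ k (suc m) = trans (cong (+ k *_) (pos-^ k m)) (sym (ℤP.pos-* k (k ℕ.^ m)))

  binomial-mod : ∀ {M} a j → (a + M) ^ j ≡ℤ a ^ j [mod M ]
  binomial-mod     a zero    = ≡ℤ-refl
  binomial-mod {M} a (suc j) =
    ≡ℤ-trans (≡ℤ-*ˡ (a + M) (binomial-mod a j)) (congruent (a ^ j) (ℤP.*-distribʳ-+ (a ^ j) a M))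

  binomial-mod-square : ∀ {M} a m → (a + M) ^ suc m ≡ℤ a ^ suc m + + suc m * M * a ^ m [mod M * M ]
  binomial-mod-square {M} a zero    = ≡ℤ-reflexive (linear a M)
    where
    linear : ∀ a M → (a + M) * + 1 ≡ a * + 1 + + 1 * M * + 1
    linear = solve-∀ ℤ-ring
  binomial-mod-square {M} a (suc m) =
    ≡ℤ-trans (≡ℤ-*ˡ (a + M) (binomial-mod-square a m)) (congruent (+ suc m * a ^ m) (expand a M (+ suc m) (a ^ m)))
    where
    expand : ∀ a M c y → (a + M) * (a * y + c * M * y) ≡ a * (a * y) + (+ 1 + c) * M * (a * y) + (M * M) * (c * y)
    expand = solve-∀ ℤ-ring

  pos-double : ∀ k → + (k ℕ.+ k) ≡ + 2 * + k
  pos-double k = trans (ℤP.pos-+ k k) (twice (+ k))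
    where
    twice : ∀ y → y + y ≡ + 2 * y
    twice = solve-∀ ℤ-ring

  pos-∸ : ∀ {m x} → x ≤ m → + (m ∸ x) ≡ - + x + + m
  pos-∸ {m} {x} x≤m = trans (sym (ℤP.⊖-≥ x≤m)) (sym (ℤP.-m+n≡n⊖m x m))

  signℤ-+ : ∀ a b → signℤ (a ℕ.+ b) ≡ signℤ a * signℤ b
  signℤ-+ zero    b = sym (ℤP.*-identityˡ (signℤ b))
  signℤ-+ (suc a) b = trans (cong -_ (signℤ-+ a b)) (ℤP.neg-distribˡ-* (signℤ a) (signℤ b))

  signℤ-double : ∀ k → signℤ (k ℕ.+ k) ≡ + 1
  signℤ-double zero    = refl
  signℤ-double (suc k) rewrite ℕP.+-suc k k = trans (ℤP.neg-involutive _) (signℤ-double k)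

  signℤ-∸ : ∀ {m x} → x ≤ m → signℤ (m ∸ x) ≡ signℤ m * signℤ x
  signℤ-∸ {m} {x} x≤m = begin
    signℤ (m ∸ x)                          ≡⟨ ℤP.*-identityʳ _ ⟨
    signℤ (m ∸ x) * + 1                    ≡⟨ cong (signℤ (m ∸ x) *_) (signℤ-double x) ⟨
    signℤ (m ∸ x) * signℤ (x ℕ.+ x)        ≡⟨ cong (signℤ (m ∸ x) *_) (signℤ-+ x x) ⟩
    signℤ (m ∸ x) * (signℤ x * signℤ x)    ≡⟨ ℤP.*-assoc (signℤ (m ∸ x)) _ _ ⟨
    signℤ (m ∸ x) * signℤ x * signℤ x      ≡⟨ cong (λ s → s * signℤ x) (signℤ-+ (m ∸ x) x) ⟨
    signℤ (m ∸ x ℕ.+ x) * signℤ x          ≡⟨ cong (λ k → signℤ k * signℤ x) (ℕP.m∸n+n≡m x≤m) ⟩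
    signℤ m * signℤ x                      ∎
    where open ≡-Reasoning

  -‿^ : ∀ a m → (- a) ^ m ≡ signℤ m * a ^ m
  -‿^ a zero    = refl
  -‿^ a (suc m) = trans (cong (- a *_) (-‿^ a m)) (move-sign a (signℤ m) (a ^ m))
    where
    move-sign : ∀ a s y → - a * (s * y) ≡ - s * (a * y)
    move-sign = solve-∀ ℤ-ring

open IntegerArithmetic

module OddReflection (h j : ℕ) where
  open import Data.Integer using (_+_; _*_; -_; _-_; _^_)

  p e n : ℕ
  p = suc (h ℕ.+ h)
  e = suc (j ℕ.+ j)
  n = suc e

  P : ℤ
  P = + p

  signℤ-p : signℤ p ≡ - + 1
  signℤ-p = cong -_ (signℤ-double h)

  signℤ-e : signℤ e ≡ - + 1
  signℤ-e = cong -_ (signℤ-double j)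

  signℤ-n : signℤ n ≡ + 1
  signℤ-n = cong (λ s → - - s) (signℤ-double j)

  power-reflect : ∀ {x} → x ≤ p → (+ (p ∸ x)) ^ n ≡ℤ (+ x) ^ n - + n * P * (+ x) ^ e [mod P * P ]
  power-reflect {x} x≤p = begin
    (+ (p ∸ x)) ^ n                                    ≡⟨ cong (_^ n) (pos-∸ x≤p) ⟩
    (- + x + P) ^ n                                    ≈⟨ binomial-mod-square (- + x) e ⟩
    (- + x) ^ n + + n * P * (- + x) ^ e                ≡⟨ cong₂ (λ s t → s + + n * P * t) (-‿^ (+ x) n) (-‿^ (+ x) e) ⟩
    signℤ n * (+ x) ^ n + + n * P * (signℤ e * (+ x) ^ e)
      ≡⟨ cong₂ (λ s t → s * (+ x) ^ n + + n * P * (t * (+ x) ^ e)) signℤ-n signℤ-e ⟩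
    + 1 * (+ x) ^ n + + n * P * (- + 1 * (+ x) ^ e)   ≡⟨ tidy ((+ x) ^ n) (+ n * P) ((+ x) ^ e) ⟩
    (+ x) ^ n - + n * P * (+ x) ^ e                    ∎
    where
    open ≡ℤ-Reasoning (P * P)
    tidy : ∀ a c b → + 1 * a + c * (- + 1 * b) ≡ a - c * b
    tidy = solve-∀ ℤ-ring

  A G X : ℤ
  A = ∑₁ h (λ k → (+ k) ^ e)
  G = ∑₁ h (λ k → (+ k) ^ n)
  X = (+ 2) ^ e

  ∑-power-reflect : (φ : ℕ → ℕ) → (∀ {k} → k < h → φ (suc k) ≤ p) →
    ∑₁ h (λ k → (+ (p ∸ φ k)) ^ n) ≡ℤ
    ∑₁ h (λ k → (+ φ k) ^ n) - + n * P * ∑₁ h (λ k → (+ φ k) ^ e) [mod P * P ]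
  ∑-power-reflect φ φ≤p =
    ≡ℤ-trans (≡ℤ-∑ h (λ k<h → power-reflect (φ≤p k<h)))
             (≡ℤ-reflexive (∑-linear h (+ n * P) (λ k → (+ φ (suc k)) ^ n) (λ k → (+ φ (suc k)) ^ e)))

  ∑-double-power : ∀ m → ∑₁ h (λ k → (+ (k ℕ.+ k)) ^ m) ≡ (+ 2) ^ m * ∑₁ h (λ k → (+ k) ^ m)
  ∑-double-power m = begin
    ∑₁ h (λ k → (+ (k ℕ.+ k)) ^ m)          ≡⟨ ∑-ext h (λ k → cong (_^ m) (pos-double (suc k))) ⟩
    ∑₁ h (λ k → (+ 2 * + k) ^ m)            ≡⟨ ∑-ext h (λ k → ^-distrib-* (+ 2) (+ suc k) m) ⟩
    ∑₁ h (λ k → (+ 2) ^ m * (+ k) ^ m)      ≡⟨ *-distribˡ-∑ h ((+ 2) ^ m) (λ k → (+ suc k) ^ m) ⟨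
    (+ 2) ^ m * ∑₁ h (λ k → (+ k) ^ m)      ∎
    where open ≡-Reasoning

  powerSum-reflect : powerSum n p ≡ℤ + 2 * G - + n * P * A [mod P * P ]
  powerSum-reflect = begin
    powerSum n p                                      ≡⟨ ∑-first (h ℕ.+ h) _ ⟩
    + 0 + ∑₁ (h ℕ.+ h) (λ k → (+ k) ^ n)              ≡⟨ cong (λ t → + 0 + t) (∑₁-reflect h (λ k → (+ k) ^ n)) ⟩
    + 0 + (G + ∑₁ h (λ k → (+ (p ∸ k)) ^ n))
      ≈⟨ ≡ℤ-+ˡ (+ 0) (≡ℤ-+ˡ G (∑-power-reflect (λ k → k) (λ k<h → ℕP.≤-trans k<h (ℕP.m≤n+m h (suc h))))) ⟩
    + 0 + (G + (G - + n * P * A))                     ≡⟨ collect G (+ n * P * A) ⟩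
    + 2 * G - + n * P * A                             ∎
    where
    open ≡ℤ-Reasoning (P * P)
    collect : ∀ g c → + 0 + (g + (g - c)) ≡ + 2 * g - c
    collect = solve-∀ ℤ-ring

  powerSum-parity : powerSum n p ≡ℤ + 4 * X * G - + n * P * (X * A) [mod P * P ]
  powerSum-parity = begin
    powerSum n p                                      ≡⟨ ∑-first (h ℕ.+ h) _ ⟩
    + 0 + ∑₁ (h ℕ.+ h) (λ k → (+ k) ^ n)              ≡⟨ cong (λ t → + 0 + t) (∑₁-parity h (λ k → (+ k) ^ n)) ⟩
    + 0 + (Dₙ + ∑₁ h (λ k → (+ (p ∸ (k ℕ.+ k))) ^ n))
      ≈⟨ ≡ℤ-+ˡ (+ 0) (≡ℤ-+ˡ Dₙ (∑-power-reflect (λ k → k ℕ.+ k) (λ k<h → ℕP.≤-trans (ℕP.+-mono-≤ k<h k<h) (ℕP.n≤1+n _)))) ⟩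
    + 0 + (Dₙ + (Dₙ - + n * P * Dₑ))
      ≡⟨ cong₂ (λ s t → + 0 + (s + (s - + n * P * t))) (∑-double-power n) (∑-double-power e) ⟩
    + 0 + (+ 2 * X * G + (+ 2 * X * G - + n * P * (X * A)))  ≡⟨ collect X G (+ n * P * (X * A)) ⟩
    + 4 * X * G - + n * P * (X * A)                   ∎
    where
    open ≡ℤ-Reasoning (P * P)
    Dₙ = ∑₁ h (λ k → (+ (k ℕ.+ k)) ^ n)
    Dₑ = ∑₁ h (λ k → (+ (k ℕ.+ k)) ^ e)
    collect : ∀ x g c → + 0 + (+ 2 * x * g + (+ 2 * x * g - c)) ≡ + 4 * x * g - c
    collect = solve-∀ ℤ-ring

  powerSum-relation : (+ 2 * X - + 1) * powerSum n p + + n * X * P * A ≡ℤ + 0 [mod P * P ]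
  powerSum-relation = begin
    (+ 2 * X - + 1) * f + + n * X * P * A
      ≡⟨ expand X f (+ n) P A ⟩
    + 2 * X * f - f + + n * X * P * A
      ≈⟨ ≡ℤ-+ (≡ℤ-+ (≡ℤ-*ˡ (+ 2 * X) powerSum-reflect) (≡ℤ-neg powerSum-parity)) (≡ℤ-refl {a = + n * X * P * A}) ⟩
    + 2 * X * (+ 2 * G - + n * P * A) - (+ 4 * X * G - + n * P * (X * A)) + + n * X * P * A
      ≡⟨ cancel X G A (+ n) P ⟩
    + 0 ∎
    where
    open ≡ℤ-Reasoning (P * P)
    f = powerSum n p
    expand : ∀ X f N P A → (+ 2 * X - + 1) * f + N * X * P * A ≡ + 2 * X * f - f + N * X * P * A
    expand = solve-∀ ℤ-ring
    cancel : ∀ X G A N P →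
      + 2 * X * (+ 2 * G - N * P * A) - (+ 4 * X * G - N * P * (X * A)) + N * X * P * A ≡ + 0
    cancel = solve-∀ ℤ-ring

  -- The integer stand-in for the term (-1) ^ k / k ^ 3 of the theorem's sum.
  summand : ℕ → ℤ
  summand k with p ∣? k
  ... | yes _ = + 0
  ... | no  _ = signℤ k * (+ k) ^ e

  summand-coprime : ∀ {k} → ¬ p ∣ k → summand k ≡ signℤ k * (+ k) ^ e
  summand-coprime {k} p∤k with p ∣? k
  ... | yes p∣k = ⊥-elim (p∤k p∣k)
  ... | no  _   = refl

  summand-p : summand p ≡ + 0
  summand-p with p ∣? p
  ... | yes _   = refl
  ... | no  p∤p = ⊥-elim (p∤p ∣-refl)

  summand-reflect : ∀ {x} → x ≤ p → summand (p ∸ x) ≡ℤ summand x [mod P ]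
  summand-reflect {x} x≤p with p ∣? x | p ∣? (p ∸ x)
  ... | yes _   | yes _     = ≡ℤ-refl
  ... | yes p∣x | no  p∤p-x = ⊥-elim (p∤p-x (∣m+n∣m⇒∣n (subst (p ∣_) (sym (ℕP.m+[n∸m]≡n x≤p)) ∣-refl) p∣x))
  ... | no  p∤x | yes p∣p-x = ⊥-elim (p∤x (∣m+n∣m⇒∣n (subst (p ∣_) (sym (ℕP.m∸n+n≡m x≤p)) ∣-refl) p∣p-x))
  ... | no  _   | no  _     = begin
    signℤ (p ∸ x) * (+ (p ∸ x)) ^ e             ≡⟨ cong₂ (λ s y → s * y ^ e) (signℤ-∸ x≤p) (pos-∸ x≤p) ⟩
    signℤ p * signℤ x * (- + x + P) ^ e         ≈⟨ ≡ℤ-*ˡ (signℤ p * signℤ x) (binomial-mod (- + x) e) ⟩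
    signℤ p * signℤ x * (- + x) ^ e             ≡⟨ cong (λ y → signℤ p * signℤ x * y) (-‿^ (+ x) e) ⟩
    signℤ p * signℤ x * (signℤ e * (+ x) ^ e)   ≡⟨ cong₂ (λ s t → s * signℤ x * (t * (+ x) ^ e)) signℤ-p signℤ-e ⟩
    - + 1 * signℤ x * (- + 1 * (+ x) ^ e)       ≡⟨ signs-cancel (signℤ x) ((+ x) ^ e) ⟩
    signℤ x * (+ x) ^ e                         ∎
    where
    open ≡ℤ-Reasoning P
    signs-cancel : ∀ s y → - + 1 * s * (- + 1 * y) ≡ s * y
    signs-cancel = solve-∀ ℤ-ring

  summand-shift : ∀ x → summand (p ℕ.+ x) ≡ℤ - summand x [mod P ]
  summand-shift x with p ∣? x | p ∣? (p ℕ.+ x)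
  ... | yes _   | yes _     = ≡ℤ-refl
  ... | yes p∣x | no  p∤p+x = ⊥-elim (p∤p+x (∣m∣n⇒∣m+n ∣-refl p∣x))
  ... | no  p∤x | yes p∣p+x = ⊥-elim (p∤x (∣m+n∣m⇒∣n p∣p+x ∣-refl))
  ... | no  _   | no  _     = begin
    signℤ (p ℕ.+ x) * (+ (p ℕ.+ x)) ^ e         ≡⟨ cong₂ (λ s y → s * y ^ e) (signℤ-+ p x) (trans (ℤP.pos-+ p x) (ℤP.+-comm P (+ x))) ⟩
    signℤ p * signℤ x * (+ x + P) ^ e           ≈⟨ ≡ℤ-*ˡ (signℤ p * signℤ x) (binomial-mod (+ x) e) ⟩
    signℤ p * signℤ x * (+ x) ^ e               ≡⟨ cong (λ s → s * signℤ x * (+ x) ^ e) signℤ-p ⟩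
    - + 1 * signℤ x * (+ x) ^ e                 ≡⟨ sign-out (signℤ x) ((+ x) ^ e) ⟩
    - (signℤ x * (+ x) ^ e)                     ∎
    where
    open ≡ℤ-Reasoning P
    sign-out : ∀ s y → - + 1 * s * y ≡ - (s * y)
    sign-out = solve-∀ ℤ-ring

  summand-double : ∀ {k} → 0 < k → k ℕ.+ k < p → summand (k ℕ.+ k) ≡ X * (+ k) ^ e
  summand-double {k} 0<k 2k<p = begin
    summand (k ℕ.+ k)                         ≡⟨ summand-coprime (λ p∣2k → ℕP.<⇒≱ 2k<p (∣⇒≤ ⦃ nonZero ⦄ p∣2k)) ⟩
    signℤ (k ℕ.+ k) * (+ (k ℕ.+ k)) ^ e       ≡⟨ cong₂ (λ s y → s * y ^ e) (signℤ-double k) (pos-double k) ⟩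
    + 1 * (+ 2 * + k) ^ e                     ≡⟨ ℤP.*-identityˡ _ ⟩
    (+ 2 * + k) ^ e                           ≡⟨ ^-distrib-* (+ 2) (+ k) e ⟩
    X * (+ k) ^ e                             ∎
    where
    open ≡-Reasoning
    nonZero = ℕ.>-nonZero (ℕP.<-≤-trans 0<k (ℕP.m≤m+n k k))

  T : ℤ
  T = ∑₁ h summand

  ∑summand-reflect : ∑₁ (h ℕ.+ h) summand ≡ℤ T + T [mod P ]
  ∑summand-reflect = begin
    ∑₁ (h ℕ.+ h) summand                    ≡⟨ ∑₁-reflect h summand ⟩
    T + ∑₁ h (λ k → summand (p ∸ k))        ≈⟨ ≡ℤ-+ˡ T (≡ℤ-∑ h (λ k<h → summand-reflect (ℕP.≤-trans k<h (ℕP.m≤n+m h (suc h))))) ⟩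
    T + T                                   ∎
    where open ≡ℤ-Reasoning P

  ∑summand-parity : ∑₁ (h ℕ.+ h) summand ≡ℤ X * A + X * A [mod P ]
  ∑summand-parity = begin
    ∑₁ (h ℕ.+ h) summand                    ≡⟨ ∑₁-parity h summand ⟩
    D + ∑₁ h (λ k → summand (p ∸ (k ℕ.+ k)))
      ≈⟨ ≡ℤ-+ˡ D (≡ℤ-∑ h (λ k<h → summand-reflect (ℕP.≤-trans (ℕP.+-mono-≤ k<h k<h) (ℕP.n≤1+n _)))) ⟩
    D + D                                   ≡⟨ cong₂ _+_ D≡XA D≡XA ⟩
    X * A + X * A                           ∎
    where
    open ≡ℤ-Reasoning P
    D = ∑₁ h (λ k → summand (k ℕ.+ k))
    D≡XA : D ≡ X * A
    D≡XA = trans (∑-cong h (λ k<h → summand-double (s≤s z≤n) (s≤s (ℕP.+-mono-≤ k<h k<h))))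
                 (sym (*-distribˡ-∑ h X (λ k → (+ suc k) ^ e)))

  ∑summand-period : ∀ N → ∑₁ (p ℕ.+ N) summand ≡ℤ (T + T) - ∑₁ N summand [mod P ]
  ∑summand-period N = begin
    ∑₁ (p ℕ.+ N) summand                                    ≡⟨ ∑₁-split p N summand ⟩
    ∑₁ (h ℕ.+ h) summand + summand p + ∑₁ N (λ k → summand (p ℕ.+ k))
      ≈⟨ ≡ℤ-+ (≡ℤ-+ ∑summand-reflect (≡ℤ-reflexive summand-p)) (≡ℤ-∑ N (λ {k} _ → summand-shift (suc k))) ⟩
    T + T + + 0 + ∑₁ N (λ k → - summand k)                   ≡⟨ cong₂ _+_ (ℤP.+-identityʳ (T + T)) (sym (neg-distrib-∑ N (λ k → summand (suc k)))) ⟩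
    (T + T) - ∑₁ N summand                                  ∎
    where open ≡ℤ-Reasoning P

  ∑summand-h+pt : ∀ t → ∑₁ (h ℕ.+ p ℕ.* t) summand ≡ℤ T [mod P ]
  ∑summand-h+pt zero    = ≡ℤ-reflexive (cong (λ N → ∑₁ N summand) (trans (cong (h ℕ.+_) (ℕP.*-zeroʳ p)) (ℕP.+-identityʳ h)))
  ∑summand-h+pt (suc t) = begin
    ∑₁ (h ℕ.+ p ℕ.* suc t) summand          ≡⟨ cong (λ N → ∑₁ N summand) (one-period h p t) ⟩
    ∑₁ (p ℕ.+ (h ℕ.+ p ℕ.* t)) summand      ≈⟨ ∑summand-period (h ℕ.+ p ℕ.* t) ⟩
    (T + T) - ∑₁ (h ℕ.+ p ℕ.* t) summand    ≈⟨ ≡ℤ-+ˡ (T + T) (≡ℤ-neg (∑summand-h+pt t)) ⟩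
    (T + T) - T                             ≡⟨ ℤP.+-assoc T T (- T) ⟩
    T + (T - T)                             ≡⟨ cong (λ t → T + t) (ℤP.+-inverseʳ T) ⟩
    T + + 0                                 ≡⟨ ℤP.+-identityʳ T ⟩
    T                                       ∎
    where
    open ≡ℤ-Reasoning P
    one-period : ∀ h p t → h ℕ.+ p ℕ.* suc t ≡ p ℕ.+ (h ℕ.+ p ℕ.* t)
    one-period = solve-∀ ℕ-ring

-- The integer sections above open the operators of ℤ locally; from here on the unqualified
-- arithmetic is that of ℚ (and of ℕ for _^_ and _/_, as in the statement).
open import Data.Nat using (_^_; _/_)
open import Data.Rational using (_+_; _*_; _-_; -_) renaming (_/_ to _÷_)

-- Without the zero test the ring solver cannot cancel coefficients such as 1 + -1.
ℚ-ring : AlmostCommutativeRing 0ℓ 0ℓ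
ℚ-ring = fromCommutativeRing ℚP.+-*-commutativeRing (λ x → dec⇒maybe (0ℚ ℚ.≟ x))

module ℚ∑ = FiniteSums ℚP.+-*-isCommutativeRing

fromℚᵘ-homo-+ : ∀ x y → ℚ.fromℚᵘ (x ℚᵘ.+ y) ≡ ℚ.fromℚᵘ x + ℚ.fromℚᵘ y
fromℚᵘ-homo-+ x y = ℚP.toℚᵘ-injective (begin-equality
  ℚ.toℚᵘ (ℚ.fromℚᵘ (x ℚᵘ.+ y))                      ≃⟨ ℚP.toℚᵘ-fromℚᵘ (x ℚᵘ.+ y) ⟩
  x ℚᵘ.+ y                                           ≃⟨ ℚᵘP.+-cong (ℚP.toℚᵘ-fromℚᵘ x) (ℚP.toℚᵘ-fromℚᵘ y) ⟨
  ℚ.toℚᵘ (ℚ.fromℚᵘ x) ℚᵘ.+ ℚ.toℚᵘ (ℚ.fromℚᵘ y)       ≃⟨ ℚP.toℚᵘ-homo-+ (ℚ.fromℚᵘ x) (ℚ.fromℚᵘ y) ⟨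
  ℚ.toℚᵘ (ℚ.fromℚᵘ x + ℚ.fromℚᵘ y)                  ∎)
  where open ℚᵘP.≤-Reasoning

fromℚᵘ-homo-* : ∀ x y → ℚ.fromℚᵘ (x ℚᵘ.* y) ≡ ℚ.fromℚᵘ x * ℚ.fromℚᵘ y
fromℚᵘ-homo-* x y = ℚP.toℚᵘ-injective (begin-equality
  ℚ.toℚᵘ (ℚ.fromℚᵘ (x ℚᵘ.* y))                      ≃⟨ ℚP.toℚᵘ-fromℚᵘ (x ℚᵘ.* y) ⟩
  x ℚᵘ.* y                                           ≃⟨ ℚᵘP.*-cong (ℚP.toℚᵘ-fromℚᵘ x) (ℚP.toℚᵘ-fromℚᵘ y) ⟨
  ℚ.toℚᵘ (ℚ.fromℚᵘ x) ℚᵘ.* ℚ.toℚᵘ (ℚ.fromℚᵘ y)       ≃⟨ ℚP.toℚᵘ-homo-* (ℚ.fromℚᵘ x) (ℚ.fromℚᵘ y) ⟨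
  ℚ.toℚᵘ (ℚ.fromℚᵘ x * ℚ.fromℚᵘ y)                  ∎)
  where open ℚᵘP.≤-Reasoning

ι : ℤ → ℚ
ι z = z ÷ 1

ιₙ : ℕ → ℚ
ιₙ n = ι (+ n)

ι-+ : ∀ a b → ι (a ℤ.+ b) ≡ ι a + ι b
ι-+ a b = trans (ℚP.fromℚᵘ-cong {mkℚᵘ (a ℤ.+ b) 0} {mkℚᵘ a 0 ℚᵘ.+ mkℚᵘ b 0} (*≡* (sum a b)))
  (fromℚᵘ-homo-+ (mkℚᵘ a 0) (mkℚᵘ b 0))
  where
  sum : ∀ a b → (a ℤ.+ b) ℤ.* + 1 ≡ (a ℤ.* + 1 ℤ.+ b ℤ.* + 1) ℤ.* + 1
  sum = solve-∀ ℤ-ring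

ι-* : ∀ a b → ι (a ℤ.* b) ≡ ι a * ι b
ι-* a b = fromℚᵘ-homo-* (mkℚᵘ a 0) (mkℚᵘ b 0)

ι-neg : ∀ a → ι (ℤ.- a) ≡ - ι a
ι-neg (+ zero)    = refl
ι-neg (+ suc n)   = refl
ι-neg ℤ.-[1+ n ]  = sym (neg-involutive (ι (+ suc n)))
  where
  neg-involutive : ∀ x → - - x ≡ x
  neg-involutive = solve-∀ ℚ-ring

ι-- : ∀ a b → ι (a ℤ.- b) ≡ ι a - ι b
ι-- a b = trans (ι-+ a (ℤ.- b)) (cong (λ t → ι a + t) (ι-neg b))

ι-∑ : ∀ n f → ι (∑ n f) ≡ ℚ∑.∑ n (λ k → ι (f k))
ι-∑ zero    f = refl
ι-∑ (suc n) f = trans (ι-+ (∑ n f) (f n)) (cong (_+ ι (f n)) (ι-∑ n f))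

ιₙ-+ : ∀ m n → ιₙ (m ℕ.+ n) ≡ ιₙ m + ιₙ n
ιₙ-+ m n = ι-+ (+ m) (+ n)

ιₙ-* : ∀ m n → ιₙ (m ℕ.* n) ≡ ιₙ m * ιₙ n
ιₙ-* m n = trans (cong ι (ℤP.pos-* m n)) (ι-* (+ m) (+ n))

÷-*-cancel : ∀ z d .{{_ : ℕ.NonZero d}} → (z ÷ d) * ιₙ d ≡ ι z
÷-*-cancel z (suc d) = trans (sym (fromℚᵘ-homo-* (mkℚᵘ z d) (mkℚᵘ (+ suc d) 0)))
  (ℚP.fromℚᵘ-cong {mkℚᵘ z d ℚᵘ.* mkℚᵘ (+ suc d) 0} {mkℚᵘ z 0}
    (*≡* (trans (cross z (+ suc d)) (cong (λ k → z ℤ.* + suc k) (sym (ℕP.*-identityʳ d))))))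
  where
  cross : ∀ z D → (z ℤ.* D) ℤ.* + 1 ≡ z ℤ.* D
  cross = solve-∀ ℤ-ring

↥q*y≡z*↧q : ∀ q y z → q * ιₙ y ≡ ι z → ↥ q ℤ.* + y ≡ z ℤ.* + ↧ₙ q
↥q*y≡z*↧q q@(mkℚ n d _) y z q*y≡z = cross-multiply (begin-equality
  mkℚᵘ n d ℚᵘ.* mkℚᵘ (+ y) 0       ≃⟨ ℚᵘP.*-cong (ℚᵘP.≃-refl {ℚ.toℚᵘ q}) (ℚP.toℚᵘ-fromℚᵘ (mkℚᵘ (+ y) 0)) ⟨
  ℚ.toℚᵘ q ℚᵘ.* ℚ.toℚᵘ (ιₙ y)      ≃⟨ ℚP.toℚᵘ-homo-* q (ιₙ y) ⟨
  ℚ.toℚᵘ (q * ιₙ y)                ≡⟨ cong ℚ.toℚᵘ q*y≡z ⟩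
  ℚ.toℚᵘ (ι z)                     ≃⟨ ℚP.toℚᵘ-fromℚᵘ (mkℚᵘ z 0) ⟩
  mkℚᵘ z 0                         ∎)
  where
  open ℚᵘP.≤-Reasoning
  cross-multiply : mkℚᵘ n d ℚᵘ.* mkℚᵘ (+ y) 0 ℚᵘ.≃ mkℚᵘ z 0 → n ℤ.* + y ≡ z ℤ.* + suc d
  cross-multiply (*≡* eq) = trans (sym (ℤP.*-identityʳ _))
    (trans eq (cong (λ k → z ℤ.* + suc k) (ℕP.*-identityʳ d)))

↧-coprime-↥ : ∀ q → Coprimality.Coprime (↧ₙ q) ℤ.∣ ↥ q ∣
↧-coprime-↥ (mkℚ _ _ coprime) = Coprimality.sym (Coprimality.recompute coprime)

module Localisation {p : ℕ} (p-prime : Prime p) where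

  p∤1 : ¬ p ∣ 1
  p∤1 p∣1 = ℕ.nonTrivial⇒≢1 ⦃ prime⇒nonTrivial p-prime ⦄ (∣1⇒≡1 p∣1)

  p∤* : ∀ {a b} → ¬ p ∣ a → ¬ p ∣ b → ¬ p ∣ a ℕ.* b
  p∤* {a} {b} p∤a p∤b p∣ab with euclidsLemma a b p-prime p∣ab
  ... | inj₁ p∣a = p∤a p∣a
  ... | inj₂ p∣b = p∤b p∣b

  record ℤ₍ₚ₎ (q : ℚ) : Set where
    constructor fraction
    field
      numerator     : ℤ
      denominator   : ℕ
      p∤denominator : ¬ p ∣ denominator
      equation      : q * ιₙ denominator ≡ ι numerator

  ℤ₍ₚ₎-ι : ∀ z → ℤ₍ₚ₎ (ι z)
  ℤ₍ₚ₎-ι z = fraction z 1 p∤1 (ℚP.*-identityʳ (ι z))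

  ℤ₍ₚ₎-÷ : ∀ z d .{{_ : ℕ.NonZero d}} → ¬ p ∣ d → ℤ₍ₚ₎ (z ÷ d)
  ℤ₍ₚ₎-÷ z d p∤d = fraction z d p∤d (÷-*-cancel z d)

  ℤ₍ₚ₎-+ : ∀ {a b} → ℤ₍ₚ₎ a → ℤ₍ₚ₎ b → ℤ₍ₚ₎ (a + b)
  ℤ₍ₚ₎-+ {a} {b} (fraction x₁ y₁ p∤y₁ eq₁) (fraction x₂ y₂ p∤y₂ eq₂) =
    fraction (x₁ ℤ.* + y₂ ℤ.+ x₂ ℤ.* + y₁) (y₁ ℕ.* y₂) (p∤* p∤y₁ p∤y₂) (begin
      (a + b) * ιₙ (y₁ ℕ.* y₂)                      ≡⟨ cong ((a + b) *_) (ιₙ-* y₁ y₂) ⟩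
      (a + b) * (ιₙ y₁ * ιₙ y₂)                     ≡⟨ cross a b (ιₙ y₁) (ιₙ y₂) ⟩
      (a * ιₙ y₁) * ιₙ y₂ + (b * ιₙ y₂) * ιₙ y₁     ≡⟨ cong₂ (λ s t → s * ιₙ y₂ + t * ιₙ y₁) eq₁ eq₂ ⟩
      ι x₁ * ιₙ y₂ + ι x₂ * ιₙ y₁                   ≡⟨ cong₂ _+_ (ι-* x₁ (+ y₂)) (ι-* x₂ (+ y₁)) ⟨
      ι (x₁ ℤ.* + y₂) + ι (x₂ ℤ.* + y₁)             ≡⟨ ι-+ (x₁ ℤ.* + y₂) (x₂ ℤ.* + y₁) ⟨
      ι (x₁ ℤ.* + y₂ ℤ.+ x₂ ℤ.* + y₁)               ∎)
    where
    open ≡-Reasoning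
    cross : ∀ a b u v → (a + b) * (u * v) ≡ (a * u) * v + (b * v) * u
    cross = solve-∀ ℚ-ring

  ℤ₍ₚ₎-* : ∀ {a b} → ℤ₍ₚ₎ a → ℤ₍ₚ₎ b → ℤ₍ₚ₎ (a * b)
  ℤ₍ₚ₎-* {a} {b} (fraction x₁ y₁ p∤y₁ eq₁) (fraction x₂ y₂ p∤y₂ eq₂) =
    fraction (x₁ ℤ.* x₂) (y₁ ℕ.* y₂) (p∤* p∤y₁ p∤y₂) (begin
      (a * b) * ιₙ (y₁ ℕ.* y₂)          ≡⟨ cong ((a * b) *_) (ιₙ-* y₁ y₂) ⟩
      (a * b) * (ιₙ y₁ * ιₙ y₂)         ≡⟨ interchange a b (ιₙ y₁) (ιₙ y₂) ⟩
      (a * ιₙ y₁) * (b * ιₙ y₂)         ≡⟨ cong₂ _*_ eq₁ eq₂ ⟩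
      ι x₁ * ι x₂                       ≡⟨ ι-* x₁ x₂ ⟨
      ι (x₁ ℤ.* x₂)                     ∎)
    where
    open ≡-Reasoning
    interchange : ∀ a b u v → (a * b) * (u * v) ≡ (a * u) * (b * v)
    interchange = solve-∀ ℚ-ring

  ℤ₍ₚ₎-neg : ∀ {a} → ℤ₍ₚ₎ a → ℤ₍ₚ₎ (- a)
  ℤ₍ₚ₎-neg {a} (fraction x y p∤y eq) = fraction (ℤ.- x) y p∤y (begin
    - a * ιₙ y     ≡⟨ ℚP.neg-distribˡ-* a (ιₙ y) ⟨
    - (a * ιₙ y)   ≡⟨ cong -_ eq ⟩
    - ι x          ≡⟨ ι-neg x ⟨
    ι (ℤ.- x)      ∎)
    where open ≡-Reasoning

  ℤ₍ₚ₎-∑ : ∀ n {f} → (∀ {k} → k < n → ℤ₍ₚ₎ (f k)) → ℤ₍ₚ₎ (ℚ∑.∑ n f)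
  ℤ₍ₚ₎-∑ = ℚ∑.∑-closed ℤ₍ₚ₎ (ℤ₍ₚ₎-ι (+ 0)) ℤ₍ₚ₎-+

  infix 4 _≈_[mod_]
  record _≈_[mod_] (a b M : ℚ) : Set where
    constructor congruent
    field
      quotient          : ℚ
      quotient-integral : ℤ₍ₚ₎ quotient
      equation          : a ≡ b + M * quotient

  ≈-reflexive : ∀ {M a b} → a ≡ b → a ≈ b [mod M ]
  ≈-reflexive {M} {a} refl = congruent 0ℚ (ℤ₍ₚ₎-ι (+ 0)) (solve (a ∷ M ∷ []) ℚ-ring)

  ≈-refl : ∀ {M a} → a ≈ a [mod M ]
  ≈-refl = ≈-reflexive refl

  ≈-sym : ∀ {M a b} → a ≈ b [mod M ] → b ≈ a [mod M ]
  ≈-sym {M} {b = b} (congruent c c∈ℤ₍ₚ₎ refl) =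
    congruent (- c) (ℤ₍ₚ₎-neg c∈ℤ₍ₚ₎) (solve (b ∷ M ∷ c ∷ []) ℚ-ring)

  ≈-trans : ∀ {M a b c} → a ≈ b [mod M ] → b ≈ c [mod M ] → a ≈ c [mod M ]
  ≈-trans {M} {c = c} (congruent x x∈ℤ₍ₚ₎ refl) (congruent y y∈ℤ₍ₚ₎ refl) =
    congruent (y + x) (ℤ₍ₚ₎-+ y∈ℤ₍ₚ₎ x∈ℤ₍ₚ₎) (solve (c ∷ M ∷ x ∷ y ∷ []) ℚ-ring)

  ≈-setoid : ℚ → Setoid 0ℓ 0ℓ
  ≈-setoid M = record
    { _≈_ = _≈_[mod M ]
    ; isEquivalence = record { refl = ≈-refl ; sym = ≈-sym ; trans = ≈-trans } }

  module ≈-Reasoning (M : ℚ) = SetoidReasoning (≈-setoid M)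

  ≈-+ : ∀ {M a b c d} → a ≈ b [mod M ] → c ≈ d [mod M ] → a + c ≈ b + d [mod M ]
  ≈-+ {M} {b = b} {d = d} (congruent x x∈ℤ₍ₚ₎ refl) (congruent y y∈ℤ₍ₚ₎ refl) =
    congruent (x + y) (ℤ₍ₚ₎-+ x∈ℤ₍ₚ₎ y∈ℤ₍ₚ₎) (solve (b ∷ d ∷ M ∷ x ∷ y ∷ []) ℚ-ring)

  ≈-+ˡ : ∀ {M a b} c → a ≈ b [mod M ] → c + a ≈ c + b [mod M ]
  ≈-+ˡ c = ≈-+ (≈-refl {a = c})

  ≈-neg : ∀ {M a b} → a ≈ b [mod M ] → - a ≈ - b [mod M ]
  ≈-neg {M} {b = b} (congruent x x∈ℤ₍ₚ₎ refl) =
    congruent (- x) (ℤ₍ₚ₎-neg x∈ℤ₍ₚ₎) (solve (b ∷ M ∷ x ∷ []) ℚ-ring)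

  ≈-*ˡ : ∀ {M a b k} → ℤ₍ₚ₎ k → a ≈ b [mod M ] → k * a ≈ k * b [mod M ]
  ≈-*ˡ {M} {b = b} {k} k∈ℤ₍ₚ₎ (congruent x x∈ℤ₍ₚ₎ refl) =
    congruent (k * x) (ℤ₍ₚ₎-* k∈ℤ₍ₚ₎ x∈ℤ₍ₚ₎) (solve (k ∷ b ∷ M ∷ x ∷ []) ℚ-ring)

  ≈-∑ : ∀ {M} n {f g} → (∀ {k} → k < n → f k ≈ g k [mod M ]) → ℚ∑.∑ n f ≈ ℚ∑.∑ n g [mod M ]
  ≈-∑ = ℚ∑.∑-preserves _≈_[mod _ ] ≈-refl ≈-+

  ≈-multiple : ∀ {M x} → ℤ₍ₚ₎ x → M * x ≈ 0ℚ [mod M ]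
  ≈-multiple {M} {x} x∈ℤ₍ₚ₎ = congruent x x∈ℤ₍ₚ₎ (sym (ℚP.+-identityˡ (M * x)))

  ≈-ι : ∀ {M a b} → a ≡ℤ b [mod M ] → ι a ≈ ι b [mod ι M ]
  ≈-ι {M} {b = b} (congruent x refl) =
    congruent (ι x) (ℤ₍ₚ₎-ι x) (trans (ι-+ b (M ℤ.* x)) (cong (λ t → ι b + t) (ι-* M x)))

  ≈-cancel : ∀ {M a b} d .{{_ : ℕ.NonZero d}} → ¬ p ∣ d →
             ιₙ d * a ≈ ιₙ d * b [mod M ] → a ≈ b [mod M ]
  ≈-cancel {M} {a} {b} d p∤d da≈db = begin
    a                              ≡⟨ undo a ⟨
    (+ 1 ÷ d) * (ιₙ d * a)         ≈⟨ ≈-*ˡ (ℤ₍ₚ₎-÷ (+ 1) d p∤d) da≈db ⟩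
    (+ 1 ÷ d) * (ιₙ d * b)         ≡⟨ undo b ⟩
    b                              ∎
    where
    open ≈-Reasoning M
    undo : ∀ x → (+ 1 ÷ d) * (ιₙ d * x) ≡ x
    undo x = trans (sym (ℚP.*-assoc (+ 1 ÷ d) (ιₙ d) x))
                   (trans (cong (_* x) (÷-*-cancel (+ 1) d)) (ℚP.*-identityˡ x))

  ≈-divide : ∀ {M a b} d .{{_ : ℕ.NonZero d}} →
             ιₙ d * a ≈ ιₙ d * b [mod ιₙ d * M ] → a ≈ b [mod M ]
  ≈-divide {M} {a} {b} d (congruent c c∈ℤ₍ₚ₎ da≡db+dMc) = congruent c c∈ℤ₍ₚ₎ (begin
    a                                   ≡⟨ ℚP.*-identityˡ a ⟨
    1ℚ * a                              ≡⟨ cong (_* a) (÷-*-cancel (+ 1) d) ⟨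
    (w * ιₙ d) * a                      ≡⟨ ℚP.*-assoc w (ιₙ d) a ⟩
    w * (ιₙ d * a)                      ≡⟨ cong (w *_) da≡db+dMc ⟩
    w * (ιₙ d * b + (ιₙ d * M) * c)     ≡⟨ distribute w (ιₙ d) b M c ⟩
    (w * ιₙ d) * b + ((w * ιₙ d) * M) * c
      ≡⟨ cong (λ u → u * b + (u * M) * c) (÷-*-cancel (+ 1) d) ⟩
    1ℚ * b + (1ℚ * M) * c               ≡⟨ cong₂ (λ s t → s + t * c) (ℚP.*-identityˡ b) (ℚP.*-identityˡ M) ⟩
    b + M * c                           ∎)
    where
    open ≡-Reasoning
    w = + 1 ÷ d
    distribute : ∀ w D b M c → w * (D * b + (D * M) * c) ≡ (w * D) * b + ((w * D) * M) * c
    distribute = solve-∀ ℚ-ring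

  q*y≡p*x⇒p∣↥q∧p∤↧q : ∀ q y x → ¬ p ∣ y → q * ιₙ y ≡ ι (+ p ℤ.* x) → p ∣ ℤ.∣ ↥ q ∣ × ¬ p ∣ ↧ₙ q
  q*y≡p*x⇒p∣↥q∧p∤↧q q y x p∤y q*y≡px = p∣↥q , p∤↧q
    where
    ∣↥q∣*y≡p*∣x∣*↧q : ℤ.∣ ↥ q ∣ ℕ.* y ≡ p ℕ.* ℤ.∣ x ∣ ℕ.* ↧ₙ q
    ∣↥q∣*y≡p*∣x∣*↧q = begin
      ℤ.∣ ↥ q ∣ ℕ.* y                  ≡⟨ ℤP.abs-* (↥ q) (+ y) ⟨
      ℤ.∣ ↥ q ℤ.* + y ∣                ≡⟨ cong ℤ.∣_∣ (↥q*y≡z*↧q q y (+ p ℤ.* x) q*y≡px) ⟩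
      ℤ.∣ + p ℤ.* x ℤ.* + ↧ₙ q ∣        ≡⟨ ℤP.abs-* (+ p ℤ.* x) (+ ↧ₙ q) ⟩
      ℤ.∣ + p ℤ.* x ∣ ℕ.* ↧ₙ q          ≡⟨ cong (ℕ._* ↧ₙ q) (ℤP.abs-* (+ p) x) ⟩
      p ℕ.* ℤ.∣ x ∣ ℕ.* ↧ₙ q            ∎
      where open ≡-Reasoning
    p∣↥q : p ∣ ℤ.∣ ↥ q ∣
    p∣↥q with euclidsLemma ℤ.∣ ↥ q ∣ y p-prime
                (divides (ℤ.∣ x ∣ ℕ.* ↧ₙ q) (trans ∣↥q∣*y≡p*∣x∣*↧q (rotate p ℤ.∣ x ∣ (↧ₙ q))))
      where
      rotate : ∀ a b c → a ℕ.* b ℕ.* c ≡ b ℕ.* c ℕ.* a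
      rotate = solve-∀ ℕ-ring
    ... | inj₁ p∣↥q = p∣↥q
    ... | inj₂ p∣y  = ⊥-elim (p∤y p∣y)
    p∤↧q : ¬ p ∣ ↧ₙ q
    p∤↧q p∣↧q = p∤y (∣-trans p∣↧q
      (Coprimality.coprime-divisor (↧-coprime-↥ q) (divides (p ℕ.* ℤ.∣ x ∣) ∣↥q∣*y≡p*∣x∣*↧q)))

  ≈⇒≡ℚ[mod] : ∀ {a b} → a ≈ b [mod ιₙ p ] → a ≡ℚ b [mod p ]
  ≈⇒≡ℚ[mod] {a} {b} (congruent c (fraction x y p∤y c*y≡x) a≡b+pc) =
    q*y≡p*x⇒p∣↥q∧p∤↧q (a - b) y x p∤y (begin
      (a - b) * ιₙ y                 ≡⟨ cong (λ t → (t - b) * ιₙ y) a≡b+pc ⟩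
      (b + ιₙ p * c - b) * ιₙ y      ≡⟨ cancel b (ιₙ p) c (ιₙ y) ⟩
      ιₙ p * (c * ιₙ y)              ≡⟨ cong (ιₙ p *_) c*y≡x ⟩
      ιₙ p * ι x                     ≡⟨ ι-* (+ p) x ⟨
      ι (+ p ℤ.* x)                  ∎)
    where
    open ≡-Reasoning
    cancel : ∀ b P c y → (b + P * c - b) * y ≡ P * (c * y)
    cancel = solve-∀ ℚ-ring

  ÷≈ι-* : ∀ x d .{{_ : ℕ.NonZero d}} y → ¬ p ∣ d →
          + d ℤ.* y ≡ℤ + 1 [mod + p ] → x ÷ d ≈ ι (x ℤ.* y) [mod ιₙ p ]
  ÷≈ι-* x d y p∤d (congruent w dy≡1+pw) =
    ≈-sym (congruent (r * ι w) (ℤ₍ₚ₎-* (ℤ₍ₚ₎-÷ x d p∤d) (ℤ₍ₚ₎-ι w)) (begin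
      ι (x ℤ.* y)                   ≡⟨ ι-* x y ⟩
      ι x * ι y                     ≡⟨ cong (_* ι y) (÷-*-cancel x d) ⟨
      r * ιₙ d * ι y                ≡⟨ ℚP.*-assoc r (ιₙ d) (ι y) ⟩
      r * (ιₙ d * ι y)              ≡⟨ cong (r *_) (ι-* (+ d) y) ⟨
      r * ι (+ d ℤ.* y)             ≡⟨ cong (λ t → r * ι t) dy≡1+pw ⟩
      r * ι (+ 1 ℤ.+ + p ℤ.* w)     ≡⟨ cong (r *_) (trans (ι-+ (+ 1) (+ p ℤ.* w)) (cong (λ t → 1ℚ + t) (ι-* (+ p) w))) ⟩
      r * (1ℚ + ιₙ p * ι w)         ≡⟨ distribute r (ιₙ p) (ι w) ⟩
      r + ιₙ p * (r * ι w)          ∎))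
    where
    open ≡-Reasoning
    r = x ÷ d
    distribute : ∀ r P w → r * (1ℚ + P * w) ≡ r + P * (r * w)
    distribute = solve-∀ ℚ-ring

-- Defs keeps the sum in the recursion of bernList private. recursionSum is a metavariable
-- that unification solves to that sum, once the with-abstractions in bernList-head have
-- turned all of its arguments into variables.
private
  HeadSatisfiesRecursion : ℕ → (ℕ → ℕ → List ℚ → ℚ) → List ℚ → Set
  HeadSatisfiesRecursion n S []      = ⊥
  HeadSatisfiesRecursion n S (b ∷ L) = b ≡ - ((+ 1 ÷ suc (suc n)) * S (suc n) 0 L)

mutual
  recursionSum : ℕ → ℕ → List ℚ → ℚ
  recursionSum = _

  private
    bernList-head : ∀ n → HeadSatisfiesRecursion n recursionSum (bernList (suc n))
    bernList-head n with + 1 ÷ suc (suc n) | bernList n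
    ... | c | L with suc n
    ...   | N with 0
    ...     | i = refl

private
  coefficient : ℕ → ℕ → ℚ
  coefficient N k = ιₙ (suc N C (N ∸ suc k))

recursionSum-bernList : ∀ N j i →
  recursionSum N i (bernList j) ≡ ℚ∑.∑ (suc j) (λ s → coefficient N (i ℕ.+ (j ∸ s)) * B s)
recursionSum-bernList N zero    i = begin
  coefficient N i * 1ℚ + 0ℚ             ≡⟨ ℚP.+-comm (coefficient N i * 1ℚ) 0ℚ ⟩
  0ℚ + coefficient N i * 1ℚ             ≡⟨ cong (λ k → 0ℚ + coefficient N k * 1ℚ) (ℕP.+-identityʳ i) ⟨
  0ℚ + coefficient N (i ℕ.+ 0) * 1ℚ     ∎
  where open ≡-Reasoning
recursionSum-bernList N (suc j) i = begin
  coefficient N i * B (suc j) + recursionSum N (suc i) (bernList j)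
    ≡⟨ cong (λ t → coefficient N i * B (suc j) + t) (recursionSum-bernList N j (suc i)) ⟩
  coefficient N i * B (suc j) + ℚ∑.∑ (suc j) (λ s → coefficient N (suc i ℕ.+ (j ∸ s)) * B s)
    ≡⟨ ℚP.+-comm (coefficient N i * B (suc j)) _ ⟩
  ℚ∑.∑ (suc j) (λ s → coefficient N (suc i ℕ.+ (j ∸ s)) * B s) + coefficient N i * B (suc j)
    ≡⟨ cong₂ _+_ (ℚ∑.∑-cong (suc j) (λ {s} s<j+1 → cong (λ k → coefficient N k * B s) (shift (ℕP.≤-pred s<j+1))))
                 (cong (λ k → coefficient N k * B (suc j)) last) ⟩
  ℚ∑.∑ (suc j) (λ s → coefficient N (i ℕ.+ (suc j ∸ s)) * B s) + coefficient N (i ℕ.+ (suc j ∸ suc j)) * B (suc j) ∎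
  where
  open ≡-Reasoning
  shift : ∀ {s} → s ≤ j → suc i ℕ.+ (j ∸ s) ≡ i ℕ.+ (suc j ∸ s)
  shift s≤j = trans (sym (ℕP.+-suc i _)) (cong (i ℕ.+_) (sym (ℕP.+-∸-assoc 1 s≤j)))
  last : i ≡ i ℕ.+ (j ∸ j)
  last = sym (trans (cong (i ℕ.+_) (ℕP.n∸n≡0 j)) (ℕP.+-identityʳ i))

B-suc : ∀ n → B (suc n) ≡ - ((+ 1 ÷ suc (suc n)) * ℚ∑.∑ (suc n) (λ s → ιₙ (suc (suc n) C s) * B s))
B-suc n = trans (bernList-head n) (cong (λ t → - ((+ 1 ÷ suc (suc n)) * t)) (trans
  (recursionSum-bernList (suc n) n 0)
  (ℚ∑.∑-cong (suc n) (λ {s} s<n+1 → cong (λ k → ιₙ (suc (suc n) C k) * B s) (ℕP.m∸[m∸n]≡n (ℕP.≤-pred s<n+1))))))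

B-recurrence : ∀ n → ιₙ (suc (suc n)) * B (suc n) ≡ - ℚ∑.∑ (suc n) (λ s → ιₙ (suc (suc n) C s) * B s)
B-recurrence n = begin
  K * B (suc n)                     ≡⟨ cong (K *_) (B-suc n) ⟩
  K * (- ((+ 1 ÷ suc (suc n)) * Σ)) ≡⟨ reorder K (+ 1 ÷ suc (suc n)) Σ ⟩
  - (((+ 1 ÷ suc (suc n)) * K) * Σ) ≡⟨ cong (λ t → - (t * Σ)) (÷-*-cancel (+ 1) (suc (suc n))) ⟩
  - (1ℚ * Σ)                        ≡⟨ cong -_ (ℚP.*-identityˡ Σ) ⟩
  - Σ                               ∎
  where
  open ≡-Reasoning
  K = ιₙ (suc (suc n))
  Σ = ℚ∑.∑ (suc n) (λ s → ιₙ (suc (suc n) C s) * B s)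
  reorder : ∀ k w x → k * (- (w * x)) ≡ - ((w * k) * x)
  reorder = solve-∀ ℚ-ring

ι-powerSum-recurrence : ∀ n N → ιₙ (suc (suc n)) * ι (powerSum (suc n) N) ≡
  ι ((+ N) ℤ.^ suc (suc n)) - ℚ∑.∑ (suc n) (λ j → ιₙ (suc (suc n) C j) * ι (powerSum j N))
ι-powerSum-recurrence n N = begin
  ιₙ K * ι (powerSum (suc n) N)                       ≡⟨ ι-* (+ K) (powerSum (suc n) N) ⟨
  ι (+ K ℤ.* powerSum (suc n) N)                      ≡⟨ cong ι (powerSum-recurrence n N) ⟩
  ι ((+ N) ℤ.^ K ℤ.- ∑ (suc n) term)                  ≡⟨ ι-- ((+ N) ℤ.^ K) (∑ (suc n) term) ⟩
  ι ((+ N) ℤ.^ K) - ι (∑ (suc n) term)                ≡⟨ cong (λ t → ι ((+ N) ℤ.^ K) - t) (ι-∑ (suc n) term) ⟩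
  ι ((+ N) ℤ.^ K) - ℚ∑.∑ (suc n) (λ j → ι (term j))
    ≡⟨ cong (λ t → ι ((+ N) ℤ.^ K) - t) (ℚ∑.∑-ext (suc n) (λ j → ι-* (+ (K C j)) (powerSum j N))) ⟩
  ι ((+ N) ℤ.^ K) - ℚ∑.∑ (suc n) (λ j → ιₙ (K C j) * ι (powerSum j N)) ∎
  where
  open ≡-Reasoning
  K = suc (suc n)
  term : ℕ → ℤ
  term j = + (K C j) ℤ.* powerSum j N

module BernoulliCongruence {p : ℕ} (p-prime : Prime p) where
  open Localisation p-prime

  p∤small : ∀ {m} → 0 < m → m < p → ¬ p ∣ m
  p∤small {suc m} _ m<p p∣m = ℕP.<⇒≱ m<p (∣⇒≤ p∣m)

  ℤ₍ₚ₎-B : ∀ n → suc n < p → ℤ₍ₚ₎ (B n)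
  ℤ₍ₚ₎-B = <-rec (λ n → suc n < p → ℤ₍ₚ₎ (B n)) step
    where
    step : ∀ n → (∀ {m} → m < n → suc m < p → ℤ₍ₚ₎ (B m)) → suc n < p → ℤ₍ₚ₎ (B n)
    step zero    _  _      = ℤ₍ₚ₎-ι (+ 1)
    step (suc n) IH n+2<p  = subst ℤ₍ₚ₎ (sym (B-suc n)) (ℤ₍ₚ₎-neg (ℤ₍ₚ₎-*
      (ℤ₍ₚ₎-÷ (+ 1) (suc (suc n)) (p∤small (s≤s z≤n) n+2<p))
      (ℤ₍ₚ₎-∑ (suc n) (λ {s} s<n+1 → ℤ₍ₚ₎-* (ℤ₍ₚ₎-ι (+ (suc (suc n) C s))) (IH s<n+1 (ℕP.<-trans (s≤s s<n+1) n+2<p))))))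

  p^[k+2]≈0 : ∀ k → ι ((+ p) ℤ.^ suc (suc k)) ≈ 0ℚ [mod ιₙ p * ιₙ p ]
  p^[k+2]≈0 k = subst (λ t → t ≈ 0ℚ [mod ιₙ p * ιₙ p ]) (sym p^[k+2]≡p*p*p^k) (≈-multiple (ℤ₍ₚ₎-ι ((+ p) ℤ.^ k)))
    where
    p^[k+2]≡p*p*p^k : ι ((+ p) ℤ.^ suc (suc k)) ≡ (ιₙ p * ιₙ p) * ι ((+ p) ℤ.^ k)
    p^[k+2]≡p*p*p^k = trans (ι-* (+ p) _)
      (trans (cong (ιₙ p *_) (ι-* (+ p) ((+ p) ℤ.^ k))) (sym (ℚP.*-assoc (ιₙ p) (ιₙ p) _)))

  -- Both sides satisfy ∑_{j ≤ n} C(n+1, j) xⱼ ≡ 0 (mod p²) for n ≥ 1: the power sums because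
  -- that sum is p ^ (n + 1), and the p Bⱼ by the recursion of the Bernoulli numbers.
  powerSum≈pB : ∀ n → suc n < p → ι (powerSum n p) ≈ ιₙ p * B n [mod ιₙ p * ιₙ p ]
  powerSum≈pB = <-rec (λ n → suc n < p → ι (powerSum n p) ≈ ιₙ p * B n [mod ιₙ p * ιₙ p ]) step
    where
    step : ∀ n → (∀ {m} → m < n → suc m < p → ι (powerSum m p) ≈ ιₙ p * B m [mod ιₙ p * ιₙ p ]) →
           suc n < p → ι (powerSum n p) ≈ ιₙ p * B n [mod ιₙ p * ιₙ p ]
    step zero    _  _     = ≈-reflexive (trans (cong ι (powerSum-zero p)) (sym (ℚP.*-identityʳ (ιₙ p))))
    step (suc n) IH n+2<p = ≈-cancel K (p∤small (s≤s z≤n) n+2<p) (begin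
      ιₙ K * ι (powerSum (suc n) p)
        ≡⟨ ι-powerSum-recurrence n p ⟩
      ι ((+ p) ℤ.^ K) - ℚ∑.∑ (suc n) (λ j → ιₙ (K C j) * ι (powerSum j p))
        ≈⟨ ≈-+ (p^[k+2]≈0 n) (≈-neg (≈-∑ (suc n) (λ {j} j<n+1 →
             ≈-*ˡ (ℤ₍ₚ₎-ι (+ (K C j))) (IH j<n+1 (ℕP.<-trans (s≤s j<n+1) n+2<p))))) ⟩
      0ℚ - ℚ∑.∑ (suc n) (λ j → ιₙ (K C j) * (ιₙ p * B j))
        ≡⟨ cong (λ t → 0ℚ - t) (trans (ℚ∑.∑-ext (suc n) (λ j → swap (ιₙ (K C j)) (ιₙ p) (B j)))
                               (sym (ℚ∑.*-distribˡ-∑ (suc n) (ιₙ p) (λ j → ιₙ (K C j) * B j)))) ⟩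
      0ℚ - ιₙ p * ℚ∑.∑ (suc n) (λ j → ιₙ (K C j) * B j)
        ≡⟨ pull-out (ιₙ p) (ℚ∑.∑ (suc n) (λ j → ιₙ (K C j) * B j)) ⟩
      ιₙ p * (- ℚ∑.∑ (suc n) (λ j → ιₙ (K C j) * B j))
        ≡⟨ cong (ιₙ p *_) (B-recurrence n) ⟨
      ιₙ p * (ιₙ K * B (suc n))
        ≡⟨ swap (ιₙ p) (ιₙ K) (B (suc n)) ⟩
      ιₙ K * (ιₙ p * B (suc n))   ∎)
      where
      open ≈-Reasoning (ιₙ p * ιₙ p)
      K = suc (suc n)
      swap : ∀ a b c → a * (b * c) ≡ b * (a * c)
      swap = solve-∀ ℚ-ring
      pull-out : ∀ a s → 0ℚ - a * s ≡ a * (- s)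
      pull-out = solve-∀ ℚ-ring

module AlternatingSum (q : ℕ) (p-prime : Prime (suc (suc (suc q) ℕ.+ suc (suc q)))) where
  open OddReflection (suc (suc q)) q
  open Localisation p-prime
  open BernoulliCongruence p-prime

  h : ℕ
  h = suc (suc q)

  x a b : ℚ
  x = ι X
  a = ι A
  b = B n

  n+3≡p : n ℕ.+ 3 ≡ p
  n+3≡p = arithmetic q
    where
    arithmetic : ∀ q → suc (suc (q ℕ.+ q)) ℕ.+ 3 ≡ suc (suc (suc q) ℕ.+ suc (suc q))
    arithmetic = solve-∀ ℕ-ring

  n+1<p : suc n < p
  n+1<p = ℕP.≤-trans (ℕP.n≤1+n _) (ℕP.≤-reflexive (trans (ℕP.+-comm 3 n) n+3≡p))

  p∤2 : ¬ p ∣ 2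
  p∤2 = p∤small (s≤s z≤n) (ℕP.≤-trans (s≤s (s≤s (s≤s z≤n))) n+1<p)

  p∤3 : ¬ p ∣ 3
  p∤3 = p∤small (s≤s z≤n) (ℕP.≤-trans (s≤s (s≤s (s≤s (s≤s z≤n)))) n+1<p)

  p∤8 : ¬ p ∣ 8
  p∤8 = p∤* p∤2 (p∤* p∤2 p∤2)

  cube*power≡1 : ∀ {k} → ¬ p ∣ k → + (k ℕ.^ 3) ℤ.* (+ k) ℤ.^ e ≡ℤ + 1 [mod P ]
  cube*power≡1 {k} p∤k = ≡ℤ-trans (≡ℤ-reflexive (begin
    + (k ℕ.^ 3) ℤ.* (+ k) ℤ.^ e    ≡⟨ cong (ℤ._* (+ k) ℤ.^ e) (pos-^ k 3) ⟨
    (+ k) ℤ.^ 3 ℤ.* (+ k) ℤ.^ e    ≡⟨ ℤP.^-distribˡ-+-* (+ k) 3 e ⟨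
    (+ k) ℤ.^ (3 ℕ.+ e)            ≡⟨ cong ((+ k) ℤ.^_) (exponent q) ⟩
    (+ k) ℤ.^ (h ℕ.+ h)            ∎)) (fermat p-prime p∤k)
    where
    open ≡-Reasoning
    exponent : ∀ q → 3 ℕ.+ suc (q ℕ.+ q) ≡ suc (suc q) ℕ.+ suc (suc q)
    exponent = solve-∀ ℕ-ring

  altSum3≈∑summand : ∀ N → altSum3 p N ≈ ι (∑₁ N summand) [mod ιₙ p ]
  altSum3≈∑summand zero = ≈-refl
  altSum3≈∑summand (suc j) with p ∣? suc j
  ... | yes _   = ≈-trans (altSum3≈∑summand j) (≈-reflexive (cong ι (sym (ℤP.+-identityʳ (∑₁ j summand)))))
  ... | no  p∤k = begin
    altSum3 p j + signℤ k ÷ (k ℕ.^ 3)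
      ≈⟨ ≈-+ (altSum3≈∑summand j) (÷≈ι-* (signℤ k) (k ℕ.^ 3) ((+ k) ℤ.^ e) p∤k³ (cube*power≡1 p∤k)) ⟩
    ι (∑₁ j summand) + ι (signℤ k ℤ.* (+ k) ℤ.^ e)
      ≡⟨ ι-+ (∑₁ j summand) _ ⟨
    ι (∑₁ j summand ℤ.+ signℤ k ℤ.* (+ k) ℤ.^ e) ∎
    where
    open ≈-Reasoning (ιₙ p)
    k = suc j
    p∤k³ : ¬ p ∣ k ℕ.^ 3
    p∤k³ = p∤* p∤k (p∤* p∤k (p∤* p∤k p∤1))

  T≈xa : ι T ≈ x * a [mod ιₙ p ]
  T≈xa = ≈-cancel 2 p∤2 (begin
    ιₙ 2 * ι T                     ≡⟨ double (ι T) ⟩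
    ι T + ι T                      ≡⟨ ι-+ T T ⟨
    ι (T ℤ.+ T)                    ≈⟨ ≈-ι (≡ℤ-trans (≡ℤ-sym ∑summand-reflect) ∑summand-parity) ⟩
    ι (X ℤ.* A ℤ.+ X ℤ.* A)        ≡⟨ trans (ι-+ (X ℤ.* A) (X ℤ.* A)) (cong₂ _+_ (ι-* X A) (ι-* X A)) ⟩
    x * a + x * a                  ≡⟨ double (x * a) ⟨
    ιₙ 2 * (x * a)                 ∎)
    where
    open ≈-Reasoning (ιₙ p)
    double : ∀ y → ιₙ 2 * y ≡ y + y
    double = solve-∀ ℚ-ring

  8x≈1 : ιₙ 8 * x ≈ 1ℚ [mod ιₙ p ]
  8x≈1 = ≈-trans (≈-reflexive (sym (ι-* (+ 8) X))) (≈-ι (cube*power≡1 p∤2))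

  bernoulli-relation : (ιₙ 2 * x - 1ℚ) * b + ιₙ n * x * a ≈ 0ℚ [mod ιₙ p ]
  bernoulli-relation = ≈-divide p (begin
    ιₙ p * ((ιₙ 2 * x - 1ℚ) * b + ιₙ n * x * a)
      ≡⟨ cong (λ c → ιₙ p * (c * b + ιₙ n * x * a)) c≡2x-1 ⟨
    ιₙ p * (c * b + ιₙ n * x * a)
      ≡⟨ distribute (ιₙ p) c b (ιₙ n) x a ⟩
    c * (ιₙ p * b) + ιₙ n * x * ιₙ p * a
      ≈⟨ ≈-+ (≈-*ˡ (ℤ₍ₚ₎-ι (+ 2 ℤ.* X ℤ.- + 1)) (≈-sym (powerSum≈pB n n+1<p))) ≈-refl ⟩
    c * ι (powerSum n p) + ιₙ n * x * ιₙ p * a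
      ≡⟨ casts ⟨
    ι relation
      ≈⟨ subst (λ M → ι relation ≈ ι (+ 0) [mod M ]) (ι-* P P) (≈-ι powerSum-relation) ⟩
    0ℚ                                  ≡⟨ ℚP.*-zeroʳ (ιₙ p) ⟨
    ιₙ p * 0ℚ                           ∎)
    where
    open ≈-Reasoning (ιₙ p * ιₙ p)
    c = ι (+ 2 ℤ.* X ℤ.- + 1)
    c≡2x-1 : c ≡ ιₙ 2 * x - 1ℚ
    c≡2x-1 = trans (ι-- (+ 2 ℤ.* X) (+ 1)) (cong (_- 1ℚ) (ι-* (+ 2) X))
    distribute : ∀ P c b N x a → P * (c * b + N * x * a) ≡ c * (P * b) + N * x * P * a
    distribute = solve-∀ ℚ-ring
    relation = (+ 2 ℤ.* X ℤ.- + 1) ℤ.* powerSum n p ℤ.+ + n ℤ.* X ℤ.* P ℤ.* A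
    casts : ι relation ≡ c * ι (powerSum n p) + ιₙ n * x * ιₙ p * a
    casts = trans (ι-+ ((+ 2 ℤ.* X ℤ.- + 1) ℤ.* powerSum n p) (+ n ℤ.* X ℤ.* P ℤ.* A)) (cong₂ _+_ (ι-* (+ 2 ℤ.* X ℤ.- + 1) (powerSum n p))
      (trans (ι-* (+ n ℤ.* X ℤ.* P) A) (cong (_* a) (trans (ι-* (+ n ℤ.* X) P) (cong (_* ιₙ p) (ι-* (+ n) X))))))

  -- Eliminates x from bernoulli-relation using 8x ≡ 1 and n + 3 = p ≡ 0.
  xa≈-b/4 : x * a ≈ - ((+ 1 ÷ 4) * b) [mod ιₙ p ]
  xa≈-b/4 = ≈-cancel 8 p∤8 (≈-cancel 3 p∤3 (begin
    ιₙ 3 * (ιₙ 8 * (x * a))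
      ≡⟨ eliminate x a b (ιₙ n) ⟩
    ιₙ 3 * (ιₙ 8 * y) + (- (ιₙ 8 * E) + (ιₙ 2 * b) * (ιₙ 8 * x - 1ℚ) + (ιₙ n + ιₙ 3) * (ιₙ 8 * x * a))
      ≡⟨ cong (λ t → ιₙ 3 * (ιₙ 8 * y) + (- (ιₙ 8 * E) + (ιₙ 2 * b) * (ιₙ 8 * x - 1ℚ) + t * (ιₙ 8 * x * a)))
              (trans (sym (ιₙ-+ n 3)) (cong ιₙ n+3≡p)) ⟩
    ιₙ 3 * (ιₙ 8 * y) + (- (ιₙ 8 * E) + (ιₙ 2 * b) * (ιₙ 8 * x - 1ℚ) + ιₙ p * (ιₙ 8 * x * a))
      ≈⟨ ≈-+ˡ (ιₙ 3 * (ιₙ 8 * y)) (≈-+ (≈-+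
           (≈-neg (≈-*ˡ (ℤ₍ₚ₎-ι (+ 8)) bernoulli-relation))
           (≈-*ˡ (ℤ₍ₚ₎-* (ℤ₍ₚ₎-ι (+ 2)) (ℤ₍ₚ₎-B n n+1<p)) (≈-+ 8x≈1 (≈-refl {a = - 1ℚ}))))
           (≈-multiple (ℤ₍ₚ₎-* (ℤ₍ₚ₎-* (ℤ₍ₚ₎-ι (+ 8)) (ℤ₍ₚ₎-ι X)) (ℤ₍ₚ₎-ι A)))) ⟩
    ιₙ 3 * (ιₙ 8 * y) + (- (ιₙ 8 * 0ℚ) + (ιₙ 2 * b) * (1ℚ - 1ℚ) + 0ℚ)
      ≡⟨ vanish (ιₙ 3 * (ιₙ 8 * y)) (ιₙ 2 * b) ⟩
    ιₙ 3 * (ιₙ 8 * y) ∎))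
    where
    open ≈-Reasoning (ιₙ p)
    y = - ((+ 1 ÷ 4) * b)
    E = (ιₙ 2 * x - 1ℚ) * b + ιₙ n * x * a
    eliminate : ∀ x a b N → ιₙ 3 * (ιₙ 8 * (x * a)) ≡
      ιₙ 3 * (ιₙ 8 * (- ((+ 1 ÷ 4) * b))) + (- (ιₙ 8 * ((ιₙ 2 * x - 1ℚ) * b + N * x * a))
        + (ιₙ 2 * b) * (ιₙ 8 * x - 1ℚ) + (N + ιₙ 3) * (ιₙ 8 * x * a))
    eliminate = solve-∀ ℚ-ring
    vanish : ∀ u v → u + (- (ιₙ 8 * 0ℚ) + v * (1ℚ - 1ℚ) + 0ℚ) ≡ u
    vanish = solve-∀ ℚ-ring

  altSum3≡-B/4 : ∀ t → altSum3 p (h ℕ.+ p ℕ.* t) ≡ℚ - ((+ 1 ÷ 4) * B n) [mod p ]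
  altSum3≡-B/4 t = ≈⇒≡ℚ[mod] (begin
    altSum3 p (h ℕ.+ p ℕ.* t)         ≈⟨ altSum3≈∑summand (h ℕ.+ p ℕ.* t) ⟩
    ι (∑₁ (h ℕ.+ p ℕ.* t) summand)    ≈⟨ ≈-ι (∑summand-h+pt t) ⟩
    ι T                               ≈⟨ T≈xa ⟩
    x * a                             ≈⟨ xa≈-b/4 ⟩
    - ((+ 1 ÷ 4) * b)                 ∎)
    where open ≈-Reasoning (ιₙ p)

parity : ∀ m → ∃[ h ] (m ≡ h ℕ.+ h ⊎ m ≡ suc (h ℕ.+ h))
parity zero    = 0 , inj₁ refl
parity (suc m) with parity m
... | h , inj₁ m≡2h   = h , inj₂ (cong suc m≡2h)
... | h , inj₂ m≡2h+1 = suc h , inj₁ (trans (cong suc m≡2h+1) (cong suc (sym (ℕP.+-suc h h))))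

prime≥5⇒≡2q+5 : ∀ {p} → Prime p → 5 ≤ p → ∃[ q ] p ≡ suc (suc (suc q) ℕ.+ suc (suc q))
prime≥5⇒≡2q+5 {p} p-prime 5≤p with parity p
... | h , inj₁ refl with prime⇒irreducible p-prime (divides h (h+h≡h*2 h))
  where
  h+h≡h*2 : ∀ h → h ℕ.+ h ≡ h ℕ.* 2
  h+h≡h*2 = solve-∀ ℕ-ring
...   | inj₁ ()
...   | inj₂ 2≡p = ⊥-elim (ℕP.≤⇒≯ 5≤p (subst (ℕ._< 5) 2≡p (s≤s (s≤s (s≤s z≤n)))))
prime≥5⇒≡2q+5 p-prime (s≤s ())                  | zero        , inj₂ refl
prime≥5⇒≡2q+5 p-prime (s≤s (s≤s (s≤s ())))      | suc zero    , inj₂ refl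
prime≥5⇒≡2q+5 p-prime 5≤p                       | suc (suc q) , inj₂ refl = q , refl

odd-^ : ∀ h m → ∃[ t ] suc (h ℕ.+ h) ^ m ≡ suc (t ℕ.+ t)
odd-^ h zero    = 0 , refl
odd-^ h (suc m) with odd-^ h m
... | t , p^m≡2t+1 = t′ , trans (cong (suc (h ℕ.+ h) ℕ.*_) p^m≡2t+1) (expand h t)
  where
  t′ = t ℕ.+ h ℕ.* suc (t ℕ.+ t)
  expand : ∀ h t → suc (h ℕ.+ h) ℕ.* suc (t ℕ.+ t) ≡
    suc ((t ℕ.+ h ℕ.* suc (t ℕ.+ t)) ℕ.+ (t ℕ.+ h ℕ.* suc (t ℕ.+ t)))
  expand = solve-∀ ℕ-ring

[p^[m+1]∸1]/2≡h+pt : ∀ h m → ∃[ t ] (suc (h ℕ.+ h) ^ suc m ∸ 1) / 2 ≡ h ℕ.+ suc (h ℕ.+ h) ℕ.* t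
[p^[m+1]∸1]/2≡h+pt h m with odd-^ h m
... | t , p^m≡2t+1 = t , (begin
  (p ^ suc m ∸ 1) / 2                ≡⟨ cong (λ k → (p ℕ.* k ∸ 1) / 2) p^m≡2t+1 ⟩
  (p ℕ.* suc (t ℕ.+ t) ∸ 1) / 2      ≡⟨ cong (λ k → (k ∸ 1) / 2) (expand h t) ⟩
  (N ℕ.* 2) / 2                      ≡⟨ m*n/n≡m N 2 ⟩
  N                                  ∎)
  where
  open ≡-Reasoning
  p = suc (h ℕ.+ h)
  N = h ℕ.+ p ℕ.* t
  expand : ∀ h t → suc (h ℕ.+ h) ℕ.* suc (t ℕ.+ t) ≡ suc ((h ℕ.+ suc (h ℕ.+ h) ℕ.* t) ℕ.* 2)
  expand = solve-∀ ℕ-ring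

lemma2p5 : (p m : ℕ) → Prime p → 5 ≤ p → 1 ≤ m →
    altSum3 p ((p ^ m ∸ 1) / 2) ≡ℚ (- ((+ 1 ÷ 4) * B (p ∸ 3))) [mod p ]
lemma2p5 p (suc m) p-prime 5≤p _ with prime≥5⇒≡2q+5 p-prime 5≤p
... | q , refl with [p^[m+1]∸1]/2≡h+pt (suc (suc q)) m
...   | t , index≡h+pt =
  subst₂ (λ N k → altSum3 p N ≡ℚ (- ((+ 1 ÷ 4) * B k)) [mod p ])
         (sym index≡h+pt) (sym (p∸3≡n q)) (AlternatingSum.altSum3≡-B/4 q p-prime t)
  where
  p∸3≡n : ∀ q → suc (suc (suc q) ℕ.+ suc (suc q)) ∸ 3 ≡ suc (suc (q ℕ.+ q))
  p∸3≡n q = trans (ℕP.+-suc q (suc q)) (cong suc (ℕP.+-suc q q))
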